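{- Let $G=(V,E)$ be a finite simple graph on $d$ vertices with chromatic number $\xi$. For each acyclic orientation $\rho$ of $G$ fix a natural labeling of $\Pi_\rho$, and for $j\ge 0$ let \[ \beta_j(q):=\sum_{\rho\in\mathcal{A}(G)}\ \sum_{\substack{\sigma\in\mathcal{L}(\Pi_\rho)\\ \operatorname{des}\sigma=j}} q^{\binom{d+1}{2}-\operatorname{comaj}\sigma}, \] so that $\chi^{\mathbf 1}_G(q,n)=\sum_{j\ge0}\beta_j(q)\left[{n+j\atop d}\right]_q$ for all positive integers $n$. Then: (1) each $\beta_j(q)$ is a polynomial in $q$ with nonnegative coefficients; (2) $\beta_0(q)=|\mathcal{A}(G)|\,q^{\binom{d+1}{2}}$; in particular, if $G$ is a tree then $\beta_0(q)=2^{d-1}q^{\binom{d+1}{2}}$; (3) the largest $j$ with $\beta_j(q)\neq 0$ is $j=d-\xi$, and \[ \beta_{d-\xi}(q)=\sum_{\substack{\text{proper colorings}\\ c:V\to[\xi]}} q^{\sum_{v\in V}c(v)}. \]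
   Context: $\chi^{\mathbf 1}_G(q,n):=\sum_c q^{\sum_{v}c(v)}$ over proper colorings $c:V\to\{1,\dots,n\}$ ($c(v)\ne c(w)$ whenever $vw\in E$). $\mathcal{A}(G)$ is the set of acyclic orientations of $G$; $\Pi_\rho$ is the poset on $V$ with $u\preceq w$ iff there is a directed path (possibly of length 0) from $u$ to $w$ in $\rho$. A natural labeling of a $d$-element poset $\Pi$ is a bijection $\omega:\Pi\to[d]$ with $\omega(x)<\omega(y)$ whenever $x\prec y$; a linear extension $y_1,\dots,y_d$ of $\Pi$ (a listing with $y_i\prec y_j\Rightarrow i<j$) is identified with the permutation $\sigma=(\omega(y_1),\dots,\omega(y_d))$, and $\mathcal{L}(\Pi)$ is the set of these permutations. $\operatorname{Des}(\sigma)=\{j\in[d-1]:\sigma(j+1)<\sigma(j)\}$, $\operatorname{des}\sigma=|\operatorname{Des}\sigma|$, $\operatorname{comaj}\sigma=\sum_{j\in\operatorname{Des}\sigma}(d-j)$. With $[k]_q=1+\cdots+q^{k-1}$, $[k]_q!=[1]_q\cdots[k]_q$, $\left[{m\atop d}\right]_q=\frac{[m]_q!}{[d]_q![m-d]_q!}$ for $m\ge d$ and $0$ for $0\le m<d$. -}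

module Defs where

open import Data.Bool using (Bool; true; false; _∧_; _∨_; not; _xor_; if_then_else_)
open import Data.Nat using (ℕ; zero; suc; _∸_; _<ᵇ_; _≡ᵇ_; _≤_; _<_)
open import Data.Nat.Combinatorics using (_C_)
open import Data.Fin using (Fin; toℕ; fromℕ; inject₁)
open import Data.Fin.Properties using (_≟_)
open import Data.List using (List; []; _∷_; map; concatMap; filterᵇ; allFin; upTo; length)
open import Data.Bool.ListAction using (all; any)
open import Data.Nat.ListAction using (sum)
open import Data.Integer using (ℤ; +_; _-_)
open import Data.Product using (Σ; ∃; _×_)
open import Relation.Nullary using (¬_)
open import Relation.Nullary.Decidable using (⌊_⌋)
open import Relation.Binary.PropositionalEquality using (_≡_)

_=ᶠ_ : ∀ {n} → Fin n → Fin n → Bool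
i =ᶠ j = ⌊ i ≟ j ⌋

_⇒ᵇ_ : Bool → Bool → Bool
a ⇒ᵇ b = not a ∨ b

consF : ∀ {a} {A : Set a} {n} → A → (Fin n → A) → Fin (suc n) → A
consF a f Fin.zero = a
consF a f (Fin.suc i) = f i

allFuns : ∀ {a} {A : Set a} (n : ℕ) → List A → List (Fin n → A)
allFuns zero xs = (λ ()) ∷ []
allFuns (suc n) xs = concatMap (λ a → map (consF a) (allFuns n xs)) xs

bools : List Bool
bools = true ∷ false ∷ []

Graph : ℕ → Set
Graph d = Fin d → Fin d → Bool

IsSimple : ∀ {d} → Graph d → Set
IsSimple {d} adj = (∀ u v → adj u v ≡ adj v u) × (∀ u → adj u u ≡ false)

-- Orientations: ρ u v = true means the arc u → v

Orientation : ℕ → Set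
Orientation d = Fin d → Fin d → Bool

isOrientationOf : ∀ {d} → Graph d → Orientation d → Bool
isOrientationOf {d} adj ρ =
  all (λ u → all (λ v →
    (adj u v ∧ (ρ u v xor ρ v u)) ∨ (not (adj u v) ∧ not (ρ u v))) (allFin d)) (allFin d)

walk : ∀ {d} → Orientation d → ℕ → Fin d → Fin d → Bool
walk ρ zero u w = u =ᶠ w
walk {d} ρ (suc k) u w = any (λ v → ρ u v ∧ walk ρ k v w) (allFin d)

-- a directed cycle exists iff there is a closed directed walk of length 1..d
hasDirectedCycle : ∀ {d} → Orientation d → Bool
hasDirectedCycle {d} ρ =
  any (λ u → any (λ k → walk ρ k u u) (map suc (upTo d))) (allFin d)

isAcyclicOrientation : ∀ {d} → Graph d → Orientation d → Bool
isAcyclicOrientation adj ρ = isOrientationOf adj ρ ∧ not (hasDirectedCycle ρ)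

acyclicOrientations : ∀ {d} → Graph d → List (Orientation d)
acyclicOrientations {d} adj =
  filterᵇ (isAcyclicOrientation adj) (allFuns d (allFuns d bools))

-- The poset Π_ρ: u ⪯ w iff a directed path (length 0..d-1) from u to w

_⊢_⪯_ : ∀ {d} → Orientation d → Fin d → Fin d → Bool
_⊢_⪯_ {d} ρ u w = any (λ k → walk ρ k u w) (upTo d)

_⊢_≺_ : ∀ {d} → Orientation d → Fin d → Fin d → Bool
ρ ⊢ u ≺ w = (ρ ⊢ u ⪯ w) ∧ not (u =ᶠ w)

-- natural labeling ω : Π_ρ → [d] (labels 1..d encoded as Fin d, i ↦ toℕ i + 1)
IsNaturalLabeling : ∀ {d} → Orientation d → (Fin d → Fin d) → Set
IsNaturalLabeling {d} ρ ω =
  (∀ x y → ω x ≡ ω y → x ≡ y) ×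
  (∀ i → ∃ λ x → ω x ≡ i) ×
  (∀ x y → (ρ ⊢ x ≺ y) ≡ true → toℕ (ω x) < toℕ (ω y))

-- a listing y_1..y_d (encoded y : Fin d → Fin d) of all elements, each once
isBijectionᵇ : ∀ {d} → (Fin d → Fin d) → Bool
isBijectionᵇ {d} y =
  all (λ i → all (λ j → (y i =ᶠ y j) ⇒ᵇ (i =ᶠ j)) (allFin d)) (allFin d) ∧
  all (λ x → any (λ i → y i =ᶠ x) (allFin d)) (allFin d)

isLinearExtension : ∀ {d} → Orientation d → (Fin d → Fin d) → Bool
isLinearExtension {d} ρ y =
  isBijectionᵇ y ∧
  all (λ i → all (λ j → (ρ ⊢ y i ≺ y j) ⇒ᵇ (toℕ i <ᵇ toℕ j)) (allFin d)) (allFin d)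

linearExtensions : ∀ {d} → Orientation d → List (Fin d → Fin d)
linearExtensions {d} ρ = filterᵇ (isLinearExtension ρ) (allFuns d (allFin d))

-- Permutation statistics; σ : Fin d → Fin d encodes σ(1..d) with values toℕ+1

-- 1-indexed lookup with default 0
at : List ℕ → ℕ → ℕ
at [] j = 0
at (x ∷ xs) zero = 0
at (x ∷ xs) (suc zero) = x
at (x ∷ xs) (suc (suc j)) = at xs (suc j)

word : ∀ {d} → (Fin d → Fin d) → List ℕ
word {d} σ = map (λ i → suc (toℕ (σ i))) (allFin d)

Des : ∀ {d} → (Fin d → Fin d) → List ℕ
Des {d} σ = filterᵇ (λ j → at (word σ) (suc j) <ᵇ at (word σ) j) (map suc (upTo (d ∸ 1)))

des : ∀ {d} → (Fin d → Fin d) → ℕ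
des σ = length (Des σ)

comaj : ∀ {d} → (Fin d → Fin d) → ℕ
comaj {d} σ = sum (map (λ j → d ∸ j) (Des σ))

-- β_j(q), represented as the list (multiset) of exponents of its monomials:
-- β_j(q) = Σ_{e ∈ β j} q^e, one entry e = C(d+1,2) - comaj σ (an integer)
-- for each pair (ρ ∈ 𝒜(G), σ ∈ ℒ(Π_ρ)) with des σ = j, where σ = ω_ρ ∘ y
-- for the linear extension y.

β : ∀ {d} → Graph d → (Orientation d → Fin d → Fin d) → ℕ → List ℤ
β {d} adj ω j =
  concatMap (λ ρ →
    concatMap (λ y →
      let σ = λ i → ω ρ (y i) in
      if des σ ≡ᵇ j then (+ (suc d C 2) - + comaj σ) ∷ [] else [])
    (linearExtensions ρ))
  (acyclicOrientations adj)

-- Colorings with colors {1..m} (encoded Fin m, color toℕ c + 1)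

isProperColoring : ∀ {d m} → Graph d → (Fin d → Fin m) → Bool
isProperColoring {d} adj c =
  all (λ u → all (λ v → adj u v ⇒ᵇ not (c u =ᶠ c v)) (allFin d)) (allFin d)

properColorings : ∀ {d} → Graph d → (m : ℕ) → List (Fin d → Fin m)
properColorings {d} adj m = filterᵇ (isProperColoring adj) (allFuns d (allFin m))

colorSum : ∀ {d m} → (Fin d → Fin m) → ℕ
colorSum {d} c = sum (map (λ v → suc (toℕ (c v))) (allFin d))

IsChromaticNumber : ∀ {d} → Graph d → ℕ → Set
IsChromaticNumber {d} adj ξ =
  (∃ λ (c : Fin d → Fin ξ) → isProperColoring adj c ≡ true) ×
  (∀ m (c : Fin d → Fin m) → isProperColoring adj c ≡ true → ξ ≤ m)

Connected : ∀ {d} → Graph d → Set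
Connected {d} adj = ∀ u w → ∃ λ k → ∃ λ (f : Fin (suc k) → Fin d) →
  f Fin.zero ≡ u × f (fromℕ k) ≡ w × (∀ (i : Fin k) → adj (f (inject₁ i)) (f (Fin.suc i)) ≡ true)

HasCycle : ∀ {d} → Graph d → Set
HasCycle {d} adj = ∃ λ k → ∃ λ (f : Fin (suc (suc (suc k))) → Fin d) →
  (∀ i j → f i ≡ f j → i ≡ j) ×
  (∀ (i : Fin (suc (suc k))) → adj (f (inject₁ i)) (f (Fin.suc i)) ≡ true) ×
  adj (f (fromℕ (suc (suc k)))) (f Fin.zero) ≡ true

IsTree : ∀ {d} → Graph d → Set
IsTree adj = Connected adj × ¬ HasCycle adj

module Submission where

-- Every pair (ρ, σ) with σ ∈ ℒ(Π_ρ) carries a greedy colouring: walking along the linear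
-- extension, open a new colour at every ascent of σ.  It is proper (an arc u → v of ρ forces an
-- ascent between u and v), it uses d - des σ colours, and its colour sum is C(d+1,2) - comaj σ.
-- So every exponent is a colour sum (nonnegative), des σ ≤ d - ξ, and the pairs with no descent
-- are the (ρ, ω_ρ⁻¹), one per acyclic orientation.  Conversely a proper ξ-colouring c determines
-- ρ (orient edges towards larger colours) and σ (list the colour classes in increasing order, each
-- in decreasing label order), and the greedy colouring of that pair is c; this is a bijection
-- between the pairs with d - ξ descents and the proper ξ-colourings.  For a tree every edge joins
-- a vertex to its parent towards a root, so the acyclic orientations are the 2^(d-1) choices of
-- directions of these edges.

-- The development lives in an anonymous module so that the order _≤_ on ℕ it uses stays out of
-- scope for the theorem, whose statement uses Data.Integer's _≤_.
module _ where

  open import Defs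
  open import Data.Bool using (Bool; true; false; _∧_; _∨_; not; _xor_; if_then_else_; T)
  import Data.Bool as Bool
  open import Data.Bool.ListAction using (all; any; and; or)
  open import Data.Bool.Properties using (T-≡; ∨-identityʳ; xor-inverseˡ; xor-inverseʳ)
  open import Data.Empty using (⊥; ⊥-elim)
  open import Data.Fin using (Fin; toℕ; fromℕ<; fromℕ; inject₁; punchOut)
  open import Data.Fin.Properties
    using (_≟_; toℕ<n; toℕ-inject₁; toℕ-fromℕ; toℕ-injective; toℕ-fromℕ<; fromℕ<-toℕ; any?; pigeonhole; punchOut-injective)
  open import Data.Integer using (ℤ; +_; _-_)
  import Data.Integer as ℤ
  open import Data.Integer.Properties using ([+m]-[+n]≡m⊖n; ⊖-≥)
  open import Data.List
    using (List; []; _∷_; _++_; map; concatMap; filter; filterᵇ; allFin; upTo; applyUpTo; tabulate; replicate; length)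
  open import Data.List.Membership.Propositional using (_∈_; find; lose; mapWith∈)
  open import Data.List.Membership.Propositional.Properties
    using (∈-allFin; ∈-upTo⁺; ∈-upTo⁻; ∈-concatMap⁺; ∈-concatMap⁻; ∈-map⁺; ∈-map⁻; ∈-filter⁺; ∈-filter⁻; ∈-AllPairs₂;
           mapWith∈-cong; mapWith∈≗map; map-mapWith∈)
  open import Data.List.Membership.Propositional.Properties.WithK using (unique∧set⇒bag)
  open import Data.List.Properties
    using (filter-notAll; filter-++; length-++; length-map; length-tabulate; map-cong; map-++; map-∘; map-tabulate;
           map-upTo; map-applyUpTo; upTo-∷ʳ)
  open import Data.List.Relation.Binary.BagAndSetEquality using (∼bag⇒↭)
  open import Data.List.Relation.Binary.Permutation.Propositional using (_↭_; ↭-sym)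
  import Data.List.Relation.Binary.Permutation.Propositional.Properties as ↭
  open import Data.List.Relation.Binary.Permutation.Propositional.Properties using (↭-length)
  open import Data.List.Relation.Unary.All as All using (All; []; _∷_)
  open import Data.List.Relation.Unary.All.Properties using (all⁺; all⁻)
  open import Data.List.Relation.Unary.AllPairs as AllPairs using (AllPairs; []; _∷_)
  import Data.List.Relation.Unary.AllPairs.Properties as AllPairsₚ
  open import Data.List.Relation.Unary.Any using (Any; here; there)
  open import Data.List.Relation.Unary.Any.Properties using (any⁺; any⁻; mapWith∈⁻; mapWith∈⁺)
  open import Data.List.Relation.Unary.Unique.Propositional using (Unique)
  import Data.List.Relation.Unary.Unique.Propositional.Properties as Uniqueₚ
  open import Data.List.Relation.Unary.Unique.Propositional.Properties using (allFin⁺)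
  open import Data.Nat using (ℕ; zero; suc; _+_; _*_; _∸_; _^_; _≤_; _<_; _<ᵇ_; _≤ᵇ_; _≡ᵇ_; z≤n; s≤s)
  import Data.Nat as ℕ
  open import Data.Nat.Combinatorics using (_C_; nC1≡n; nCk+nC[k+1]≡[n+1]C[k+1])
  open import Data.Nat.ListAction using (sum)
  open import Data.Nat.ListAction.Properties using (sum-++; sum-↭)
  open import Data.Nat.Properties
    using (<ᵇ⇒<; <⇒<ᵇ; ≡ᵇ⇒≡; ≡⇒≡ᵇ; ≤⇒≤ᵇ; ≤ᵇ⇒≤; _<?_; _≤?_; suc-injective; 1+n≢n;
           ≤-refl; ≤-reflexive; ≤-trans; ≤-antisym; ≤-total; ≤-pred; <⇒≤; <-≤-trans; ≤-<-trans; <-trans; <-irrefl; <-asym;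
           <-cmp; <⇒≢; <⇒≯; ≰⇒>; ≮⇒≥; ≤∧≢⇒<; m≤n⇒m<n∨m≡n; n<1+n; n≤1+n; m≤n⇒m≤1+n; n≤0⇒n≡0; m≤m+n; m≤n+m;
           +-identityʳ; +-comm; +-assoc; +-suc; *-zeroʳ; +-monoˡ-≤; +-monoʳ-≤; +-cancelʳ-≤; +-cancelʳ-<;
           m+[n∸m]≡n; m+n∸n≡m; m+n∸m≡n; n∸n≡0; m∸n≤m; +-∸-assoc; ∸-+-assoc; ∸-monoʳ-≤; ∸-monoʳ-<; ∸-cancelˡ-≡; ∸-cancelʳ-≤;
           module ≤-Reasoning)
  open import Data.Nat.Tactic.RingSolver using (solve-∀)
  open import Data.Product using (∃; _×_; _,_; proj₁; proj₂)
  open import Data.Sum using (_⊎_; inj₁; inj₂)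
  open import Data.Unit using (tt)
  open import Function using (_∘_; mk⇔; Equivalence; case_of_)
  open import Relation.Binary using (tri<; tri≈; tri>) renaming (Decidable to Decidable₂)
  open import Relation.Binary.PropositionalEquality
    using (_≡_; _≢_; _≗_; refl; sym; trans; cong; cong₂; subst; subst₂; module ≡-Reasoning)
  open import Relation.Nullary using (¬_; Dec; yes; no; ¬?)
  open import Relation.Nullary.Decidable using (T?; toWitness; fromWitness; _⊎-dec_; _×-dec_)
  open import Relation.Unary using (Decidable)

  T⇒≡true : ∀ {b} → T b → b ≡ true
  T⇒≡true = Equivalence.to T-≡

  ≡true⇒T : ∀ {b} → b ≡ true → T b
  ≡true⇒T = Equivalence.from T-≡

  module _ {A : Set} (p : A → Bool) where

    all-true⁻ : ∀ {xs} → all p xs ≡ true → ∀ {x} → x ∈ xs → p x ≡ true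
    all-true⁻ {xs} h x∈xs = T⇒≡true (All.lookup (all⁺ p xs (≡true⇒T h)) x∈xs)

    all-true⁺ : ∀ {xs} → (∀ {x} → x ∈ xs → p x ≡ true) → all p xs ≡ true
    all-true⁺ h = T⇒≡true (all⁻ p (All.tabulate (≡true⇒T ∘ h)))

    any-true⁻ : ∀ {xs} → any p xs ≡ true → ∃ λ x → x ∈ xs × p x ≡ true
    any-true⁻ {xs} h with x , x∈xs , px ← find (any⁻ p xs (≡true⇒T h)) = x , x∈xs , T⇒≡true px

    any-true⁺ : ∀ {xs x} → x ∈ xs → p x ≡ true → any p xs ≡ true
    any-true⁺ x∈xs px = T⇒≡true (any⁺ p (lose x∈xs (≡true⇒T px)))

    any-false⁻ : ∀ {xs} → any p xs ≡ false → ∀ {x} → x ∈ xs → p x ≡ false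
    any-false⁻ h {x} x∈xs with p x in px
    ... | false = refl
    ... | true with () ← trans (sym (any-true⁺ x∈xs px)) h

    any-false⁺ : ∀ {xs} → (∀ {x} → x ∈ xs → p x ≡ false) → any p xs ≡ false
    any-false⁺ {[]} h = refl
    any-false⁺ {x ∷ xs} h rewrite h (here refl) = any-false⁺ (h ∘ there)

    ∈-filterᵇ⁻ : ∀ {xs x} → x ∈ filterᵇ p xs → x ∈ xs × p x ≡ true
    ∈-filterᵇ⁻ x∈ with x∈xs , px ← ∈-filter⁻ (T? ∘ p) x∈ = x∈xs , T⇒≡true px

    ∈-filterᵇ⁺ : ∀ {xs x} → x ∈ xs → p x ≡ true → x ∈ filterᵇ p xs
    ∈-filterᵇ⁺ x∈xs px = ∈-filter⁺ (T? ∘ p) x∈xs (≡true⇒T px)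

    filterᵇ-none : ∀ {xs} → (∀ {x} → x ∈ xs → p x ≡ false) → filterᵇ p xs ≡ []
    filterᵇ-none {[]} h = refl
    filterᵇ-none {x ∷ xs} h rewrite h (here refl) = filterᵇ-none (h ∘ there)

    length-filterᵇ≡0⁻ : ∀ {xs} → length (filterᵇ p xs) ≡ 0 → ∀ {x} → x ∈ xs → p x ≡ false
    length-filterᵇ≡0⁻ {xs} empty {x} x∈ with p x in px
    ... | false = refl
    ... | true with filterᵇ p xs | empty | ∈-filterᵇ⁺ x∈ px
    ...   | [] | _ | ()

    filterᵇ-complete : ∀ {R : A → A → Set} → (∀ {x y} → R x y → p x ≡ p y) →
                       ∀ {x xs} → p x ≡ true → Any (R x) xs → ∃ λ y → y ∈ filterᵇ p xs × R x y
    filterᵇ-complete p-resp px rx with y , y∈ , r ← find rx =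
      y , ∈-filterᵇ⁺ y∈ (trans (sym (p-resp r)) px) , r

  module _ {n : ℕ} (p : Fin n → Bool) where

    allFin-true⁻ : all p (allFin n) ≡ true → ∀ i → p i ≡ true
    allFin-true⁻ h i = all-true⁻ p h (∈-allFin i)

    allFin-true⁺ : (∀ i → p i ≡ true) → all p (allFin n) ≡ true
    allFin-true⁺ h = all-true⁺ p {allFin n} (λ {i} _ → h i)

    anyFin-true⁻ : any p (allFin n) ≡ true → ∃ λ i → p i ≡ true
    anyFin-true⁻ h with i , _ , pi ← any-true⁻ p {allFin n} h = i , pi

    anyFin-true⁺ : ∀ i → p i ≡ true → any p (allFin n) ≡ true
    anyFin-true⁺ i = any-true⁺ p (∈-allFin i)

  module _ {n : ℕ} {i j : Fin n} where

    =ᶠ⇒≡ : (i =ᶠ j) ≡ true → i ≡ j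
    =ᶠ⇒≡ e = toWitness (≡true⇒T e)

    ≡⇒=ᶠ : i ≡ j → (i =ᶠ j) ≡ true
    ≡⇒=ᶠ e = T⇒≡true (fromWitness e)

    ≢⇒=ᶠ-false : i ≢ j → (i =ᶠ j) ≡ false
    ≢⇒=ᶠ-false i≢j with i ≟ j
    ... | yes i≡j = ⊥-elim (i≢j i≡j)
    ... | no _ = refl

    =ᶠ-false⇒≢ : (i =ᶠ j) ≡ false → i ≢ j
    =ᶠ-false⇒≢ e i≡j with () ← trans (sym e) (≡⇒=ᶠ i≡j)

  module _ {m n : ℕ} where

    <ᵇ-true⇒< : (m <ᵇ n) ≡ true → m < n
    <ᵇ-true⇒< e = <ᵇ⇒< m n (≡true⇒T e)

    <⇒<ᵇ-true : m < n → (m <ᵇ n) ≡ true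
    <⇒<ᵇ-true m<n = T⇒≡true (<⇒<ᵇ m<n)

    ≮⇒<ᵇ-false : ¬ m < n → (m <ᵇ n) ≡ false
    ≮⇒<ᵇ-false m≮n with m <ᵇ n in e
    ... | false = refl
    ... | true = ⊥-elim (m≮n (<ᵇ-true⇒< e))

    ≡ᵇ-true⇒≡ : (m ≡ᵇ n) ≡ true → m ≡ n
    ≡ᵇ-true⇒≡ e = ≡ᵇ⇒≡ m n (≡true⇒T e)

    ≡⇒≡ᵇ-true : m ≡ n → (m ≡ᵇ n) ≡ true
    ≡⇒≡ᵇ-true e = T⇒≡true (≡⇒≡ᵇ m n e)

    ≢⇒≡ᵇ-false : m ≢ n → (m ≡ᵇ n) ≡ false
    ≢⇒≡ᵇ-false m≢n with m ≡ᵇ n in e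
    ... | false = refl
    ... | true = ⊥-elim (m≢n (≡ᵇ-true⇒≡ e))

  ∧-true⁻ : ∀ {a b} → a ∧ b ≡ true → a ≡ true × b ≡ true
  ∧-true⁻ {true} e = refl , e

  ∧-true⁺ : ∀ {a b} → a ≡ true → b ≡ true → a ∧ b ≡ true
  ∧-true⁺ refl refl = refl

  ⇒ᵇ-true⁻ : ∀ {a b} → (a ⇒ᵇ b) ≡ true → a ≡ true → b ≡ true
  ⇒ᵇ-true⁻ {true} e refl = e

  ⇒ᵇ-true⁺ : ∀ {a b} → (a ≡ true → b ≡ true) → (a ⇒ᵇ b) ≡ true
  ⇒ᵇ-true⁺ {true} h = h refl
  ⇒ᵇ-true⁺ {false} h = refl

  not-true⁻ : ∀ {a} → not a ≡ true → a ≡ false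
  not-true⁻ {false} _ = refl

  all-cong : ∀ {A : Set} {p q : A → Bool} → p ≗ q → ∀ xs → all p xs ≡ all q xs
  all-cong p≗q xs = cong and (map-cong p≗q xs)

  any-cong : ∀ {A : Set} {p q : A → Bool} → p ≗ q → ∀ xs → any p xs ≡ any q xs
  any-cong p≗q xs = cong or (map-cong p≗q xs)

  filterᵇ-upTo-suc : (p : ℕ → Bool) (m : ℕ) →
    filterᵇ p (upTo (suc m)) ≡ filterᵇ p (upTo m) ++ (if p m then m ∷ [] else [])
  filterᵇ-upTo-suc p m = begin
    filterᵇ p (upTo (suc m))              ≡⟨ cong (filterᵇ p) (upTo-∷ʳ m) ⟨
    filterᵇ p (upTo m ++ m ∷ [])          ≡⟨ filter-++ (T? ∘ p) (upTo m) (m ∷ []) ⟩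
    filterᵇ p (upTo m) ++ filterᵇ p (m ∷ []) ≡⟨ cong (filterᵇ p (upTo m) ++_) last ⟩
    filterᵇ p (upTo m) ++ (if p m then m ∷ [] else []) ∎
    where
    open ≡-Reasoning
    last : filterᵇ p (m ∷ []) ≡ (if p m then m ∷ [] else [])
    last with p m
    ... | true = refl
    ... | false = refl

  sum-map-filterᵇ-upTo-suc : (f : ℕ → ℕ) (p : ℕ → Bool) (m : ℕ) →
    sum (map f (filterᵇ p (upTo (suc m)))) ≡ sum (map f (filterᵇ p (upTo m))) + (if p m then f m else 0)
  sum-map-filterᵇ-upTo-suc f p m = begin
    sum (map f (filterᵇ p (upTo (suc m))))
      ≡⟨ cong (sum ∘ map f) (filterᵇ-upTo-suc p m) ⟩
    sum (map f (filterᵇ p (upTo m) ++ (if p m then m ∷ [] else [])))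
      ≡⟨ cong sum (map-++ f (filterᵇ p (upTo m)) _) ⟩
    sum (map f (filterᵇ p (upTo m)) ++ map f (if p m then m ∷ [] else []))
      ≡⟨ sum-++ (map f (filterᵇ p (upTo m))) _ ⟩
    sum (map f (filterᵇ p (upTo m))) + sum (map f (if p m then m ∷ [] else []))
      ≡⟨ cong (sum (map f (filterᵇ p (upTo m))) ℕ.+_) last ⟩
    sum (map f (filterᵇ p (upTo m))) + (if p m then f m else 0) ∎
    where
    open ≡-Reasoning
    last : sum (map f (if p m then m ∷ [] else [])) ≡ (if p m then f m else 0)
    last with p m
    ... | true = +-identityʳ (f m)
    ... | false = refl

  sum-map-upTo-suc : (f : ℕ → ℕ) (m : ℕ) → sum (map f (upTo (suc m))) ≡ sum (map f (upTo m)) + f m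
  sum-map-upTo-suc f m = begin
    sum (map f (upTo (suc m)))        ≡⟨ cong (sum ∘ map f) (upTo-∷ʳ m) ⟨
    sum (map f (upTo m ++ m ∷ []))    ≡⟨ cong sum (map-++ f (upTo m) (m ∷ [])) ⟩
    sum (map f (upTo m) ++ f m ∷ [])  ≡⟨ sum-++ (map f (upTo m)) (f m ∷ []) ⟩
    sum (map f (upTo m)) + (f m + 0)  ≡⟨ cong (sum (map f (upTo m)) ℕ.+_) (+-identityʳ (f m)) ⟩
    sum (map f (upTo m)) + f m        ∎
    where open ≡-Reasoning

  filterᵇ-map-suc : (p : ℕ → Bool) (xs : List ℕ) → filterᵇ p (map suc xs) ≡ map suc (filterᵇ (p ∘ suc) xs)
  filterᵇ-map-suc p [] = refl
  filterᵇ-map-suc p (x ∷ xs) with p (suc x)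
  ... | true = cong (suc x ∷_) (filterᵇ-map-suc p xs)
  ... | false = filterᵇ-map-suc p xs

  concatMap-if≡map-filterᵇ : ∀ {A B C : Set} (L : A → List B) (P : A → B → Bool) (F : A → B → C) (xs : List A) →
    concatMap (λ x → concatMap (λ y → if P x y then F x y ∷ [] else []) (L x)) xs
    ≡ map (λ p → F (proj₁ p) (proj₂ p)) (filterᵇ (λ p → P (proj₁ p) (proj₂ p)) (concatMap (λ x → map (x ,_) (L x)) xs))
  concatMap-if≡map-filterᵇ L P F [] = refl
  concatMap-if≡map-filterᵇ {A} {B} {C} L P F (x ∷ xs) = begin
    inner (L x) ++ rest                                                ≡⟨ cong₂ _++_ (inner≡ (L x)) (concatMap-if≡map-filterᵇ L P F xs) ⟩
    map F′ (filterᵇ P′ (map (x ,_) (L x))) ++ map F′ (filterᵇ P′ pairs) ≡⟨ map-++ F′ (filterᵇ P′ (map (x ,_) (L x))) _ ⟨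
    map F′ (filterᵇ P′ (map (x ,_) (L x)) ++ filterᵇ P′ pairs)          ≡⟨ cong (map F′) (filter-++ (T? ∘ P′) (map (x ,_) (L x)) pairs) ⟨
    map F′ (filterᵇ P′ (map (x ,_) (L x) ++ pairs))                    ∎
    where
    open ≡-Reasoning
    F′ : A × B → C
    F′ p = F (proj₁ p) (proj₂ p)
    P′ : A × B → Bool
    P′ p = P (proj₁ p) (proj₂ p)
    pairs : List (A × B)
    pairs = concatMap (λ x → map (x ,_) (L x)) xs
    rest : List C
    rest = concatMap (λ x → concatMap (λ y → if P x y then F x y ∷ [] else []) (L x)) xs
    inner : List B → List C
    inner = concatMap (λ y → if P x y then F x y ∷ [] else [])
    inner≡ : ∀ ys → inner ys ≡ map F′ (filterᵇ P′ (map (x ,_) ys))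
    inner≡ [] = refl
    inner≡ (y ∷ ys) with P x y
    ... | true = cong (F x y ∷_) (inner≡ ys)
    ... | false = inner≡ ys

  map-const : ∀ {A B : Set} (b : B) (xs : List A) → map (λ _ → b) xs ≡ replicate (length xs) b
  map-const b [] = refl
  map-const b (x ∷ xs) = cong (b ∷_) (map-const b xs)

  Pointwise : {A : Set} {n : ℕ} → (A → A → Set) → (Fin n → A) → (Fin n → A) → Set
  Pointwise R f g = ∀ i → R (f i) (g i)

  Distinct : {A : Set} → (A → A → Set) → List A → Set
  Distinct R = AllPairs (λ x y → ¬ R x y)

  module _ {A : Set} {R : A → A → Set} where

    distinct⇒≡ : (∀ {x y} → R x y → R y x) → ∀ {xs} → Distinct R xs →
                 ∀ {x y} → x ∈ xs → y ∈ xs → R x y → x ≡ y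
    distinct⇒≡ R-sym dxs x∈ y∈ r with ∈-AllPairs₂ dxs x∈ y∈
    ... | inj₁ x≡y = x≡y
    ... | inj₂ (inj₁ ¬r) = ⊥-elim (¬r r)
    ... | inj₂ (inj₂ ¬r) = ⊥-elim (¬r (R-sym r))

    distinct⇒unique : (∀ {x} → R x x) → ∀ {xs} → Distinct R xs → Unique xs
    distinct⇒unique R-refl = AllPairs.map (λ { ¬r refl → ¬r R-refl })

    allFuns-complete : ∀ n {xs} (f : Fin n → A) → (∀ i → Any (R (f i)) xs) →
                       Any (Pointwise R f) (allFuns n xs)
    allFuns-complete zero f h = here (λ ())
    allFuns-complete (suc n) f h
      with a , a∈ , ra ← find (h Fin.zero)
         | g , g∈ , rg ← find (allFuns-complete n (f ∘ Fin.suc) (h ∘ Fin.suc))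
      = lose (∈-concatMap⁺ _ (lose a∈ (∈-map⁺ (consF a) g∈))) pointwise
      where
      pointwise : Pointwise R f (consF a g)
      pointwise Fin.zero = ra
      pointwise (Fin.suc i) = rg i

    allFuns-distinct : ∀ n {xs} → Distinct R xs → Distinct (Pointwise R) (allFuns n xs)
    allFuns-distinct zero dxs = [] ∷ []
    allFuns-distinct (suc n) {xs} dxs = go dxs
      where
      extend : A → List (Fin (suc n) → A)
      extend a = map (consF a) (allFuns n xs)

      go : ∀ {as} → Distinct R as → Distinct (Pointwise R) (concatMap extend as)
      go [] = []
      go {a ∷ as} (a≉as ∷ das) =
        AllPairsₚ.++⁺ (AllPairsₚ.map⁺ (AllPairs.map (λ ¬r r → ¬r (r ∘ Fin.suc)) (allFuns-distinct n dxs)))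
                      (go das)
                      (All.tabulate λ f∈ → All.tabulate λ g∈ → apart f∈ g∈)
        where
        apart : ∀ {f g} → f ∈ extend a → g ∈ concatMap extend as → ¬ Pointwise R f g
        apart f∈ g∈ r
          with _ , _ , refl ← ∈-map⁻ (consF a) f∈
             | b , b∈ , g∈′ ← find (∈-concatMap⁻ extend {xs = as} g∈)
          with _ , _ , refl ← ∈-map⁻ (consF b) g∈′
          = All.lookup a≉as b∈ (r Fin.zero)

  length-allFuns : ∀ {A : Set} n (xs : List A) → length (allFuns n xs) ≡ length xs ^ n
  length-allFuns zero xs = refl
  length-allFuns (suc n) xs = go xs
    where
    go : ∀ as → length (concatMap (λ a → map (consF a) (allFuns n xs)) as) ≡ length as * length xs ^ n
    go [] = refl
    go (a ∷ as) = begin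
      length (map (consF a) (allFuns n xs) ++ _)       ≡⟨ length-++ (map (consF a) (allFuns n xs)) ⟩
      length (map (consF a) (allFuns n xs)) + _        ≡⟨ cong₂ _+_ (trans (length-map (consF a) (allFuns n xs)) (length-allFuns n xs)) (go as) ⟩
      length xs ^ n + length as * length xs ^ n        ∎
      where open ≡-Reasoning

  unique-mapWith∈ : ∀ {A B : Set} {xs : List A} (ψ : ∀ {x} → x ∈ xs → B) → Unique xs →
                    (∀ {x x′} (x∈ : x ∈ xs) (x′∈ : x′ ∈ xs) → ψ x∈ ≡ ψ x′∈ → x ≡ x′) →
                    Unique (mapWith∈ xs ψ)
  unique-mapWith∈ {xs = []} ψ [] inj = []
  unique-mapWith∈ {xs = x ∷ xs} ψ (x∉xs ∷ uxs) inj =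
    All.tabulate (λ z∈ ψx≡z → apart z∈ ψx≡z) ∷ unique-mapWith∈ (ψ ∘ there) uxs (λ x∈ x′∈ → inj (there x∈) (there x′∈))
    where
    apart : ∀ {z} → z ∈ mapWith∈ xs (ψ ∘ there) → ψ (here refl) ≢ z
    apart z∈ ψx≡z with x′ , x′∈ , z≡ψx′ ← mapWith∈⁻ xs (ψ ∘ there) z∈ =
      All.lookup x∉xs x′∈ (inj (here refl) (there x′∈) (trans ψx≡z z≡ψx′))

  module _ {A B C : Set} (R : A → B → Set) {xs : List A} {ys : List B} where

    ↭-correspondence :
      (f : A → C) (g : B → C) → Unique xs → Unique ys →
      (∀ {x} → x ∈ xs → ∃ λ y → y ∈ ys × R x y) →
      (∀ {y} → y ∈ ys → ∃ λ x → x ∈ xs × R x y) →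
      (∀ {x y y′} → x ∈ xs → y ∈ ys → y′ ∈ ys → R x y → R x y′ → y ≡ y′) →
      (∀ {x x′ y} → x ∈ xs → x′ ∈ xs → y ∈ ys → R x y → R x′ y → x ≡ x′) →
      (∀ {x y} → x ∈ xs → y ∈ ys → R x y → f x ≡ g y) →
      map f xs ↭ map g ys
    ↭-correspondence f g uxs uys image preimage functional injective weight =
      subst (_↭ map g ys) (sym map-f≡map-g-ψ) (↭.map⁺ g (∼bag⇒↭ (unique∧set⇒bag uψ uys (mk⇔ to from))))
      where
      ψ : ∀ {x} → x ∈ xs → B
      ψ x∈ = proj₁ (image x∈)

      ψ∈ : ∀ {x} (x∈ : x ∈ xs) → ψ x∈ ∈ ys
      ψ∈ x∈ = proj₁ (proj₂ (image x∈))

      ψR : ∀ {x} (x∈ : x ∈ xs) → R x (ψ x∈)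
      ψR x∈ = proj₂ (proj₂ (image x∈))

      uψ : Unique (mapWith∈ xs ψ)
      uψ = unique-mapWith∈ ψ uxs λ x∈ x′∈ eq →
        injective x∈ x′∈ (ψ∈ x′∈) (subst (R _) eq (ψR x∈)) (ψR x′∈)

      to : ∀ {z} → z ∈ mapWith∈ xs ψ → z ∈ ys
      to z∈ with _ , x∈ , refl ← mapWith∈⁻ xs ψ z∈ = ψ∈ x∈

      from : ∀ {y} → y ∈ ys → y ∈ mapWith∈ xs ψ
      from y∈ with x , x∈ , r ← preimage y∈ =
        mapWith∈⁺ ψ (x , x∈ , functional x∈ y∈ (ψ∈ x∈) r (ψR x∈))

      map-f≡map-g-ψ : map f xs ≡ map g (mapWith∈ xs ψ)
      map-f≡map-g-ψ = begin
        map f xs                        ≡⟨ mapWith∈≗map f xs ⟨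
        mapWith∈ xs (λ {x} _ → f x)     ≡⟨ mapWith∈-cong xs _ _ (λ x∈ → weight x∈ (ψ∈ x∈) (ψR x∈)) ⟩
        mapWith∈ xs (g ∘ ψ)             ≡⟨ map-mapWith∈ xs ψ g ⟨
        map g (mapWith∈ xs ψ)           ∎
        where open ≡-Reasoning

  sum-allFin≡sum-upTo : ∀ n (f : ℕ → ℕ) → sum (map (f ∘ toℕ) (allFin n)) ≡ sum (map f (upTo n))
  sum-allFin≡sum-upTo n f = cong sum (trans (map-tabulate (λ i → i) (f ∘ toℕ)) (trans (tabulate-toℕ n f) (sym (map-upTo f n))))
    where
    tabulate-toℕ : ∀ n (f : ℕ → ℕ) → tabulate (f ∘ toℕ {n}) ≡ applyUpTo f n
    tabulate-toℕ zero f = refl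
    tabulate-toℕ (suc n) f = cong (f 0 ∷_) (tabulate-toℕ n (f ∘ suc))

  sum-permute : ∀ {n} (π : Fin n → Fin n) → (∀ {i j} → π i ≡ π j → i ≡ j) → (∀ v → ∃ λ i → π i ≡ v) →
                (h : Fin n → ℕ) → sum (map (h ∘ π) (allFin n)) ≡ sum (map h (allFin n))
  sum-permute {n} π injective surjective h = sum-↭
    (↭-correspondence (λ i v → π i ≡ v) (h ∘ π) h (allFin⁺ n) (allFin⁺ n)
      (λ {i} _ → π i , ∈-allFin (π i) , refl)
      (λ {v} _ → let i , e = surjective v in i , ∈-allFin i , e)
      (λ _ _ _ e e′ → trans (sym e) e′)
      (λ _ _ _ e e′ → injective (trans e (sym e′)))
      (λ { _ _ refl → refl }))

  ∸≡suc∸suc : ∀ {m n} → m < n → n ∸ m ≡ suc (n ∸ suc m)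
  ∸≡suc∸suc m<n = +-∸-assoc 1 m<n

  ∑[N∸suc-k]≡NC2 : ∀ N → sum (map (λ k → N ∸ suc k) (upTo N)) ≡ N C 2
  ∑[N∸suc-k]≡NC2 zero = refl
  ∑[N∸suc-k]≡NC2 (suc N) = begin
    N + sum (map (λ k → N ∸ k) (applyUpTo suc N))  ≡⟨ cong (λ xs → N + sum xs) (map-applyUpTo suc (N ∸_) N) ⟩
    N + sum (applyUpTo (λ k → N ∸ suc k) N)        ≡⟨ cong (λ xs → N + sum xs) (map-upTo (λ k → N ∸ suc k) N) ⟨
    N + sum (map (λ k → N ∸ suc k) (upTo N))       ≡⟨ cong₂ _+_ (nC1≡n N) (sym (∑[N∸suc-k]≡NC2 N)) ⟨
    N C 1 + N C 2                                  ≡⟨ nCk+nC[k+1]≡[n+1]C[k+1] N 1 ⟩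
    suc N C 2                                      ∎
    where open ≡-Reasoning

  <⇒≤∸1 : ∀ {l n} → l < n → l ≤ n ∸ 1
  <⇒≤∸1 {n = suc n} (s≤s l≤n) = l≤n

  <∸1⇒1+< : ∀ {l n} → l < n ∸ 1 → suc l < n
  <∸1⇒1+< {n = suc n} l<n = s≤s l<n

  ∸1< : ∀ {l n} → l < n → n ∸ 1 < n
  ∸1< {n = suc n} _ = n<1+n n

  +n-+m≡+[n∸m] : ∀ {m n} → m ≤ n → + n - + m ≡ + (n ∸ m)
  +n-+m≡+[n∸m] {m} {n} m≤n = trans ([+m]-[+n]≡m⊖n n m) (⊖-≥ m≤n)

  module _ (F : ℕ → ℕ) (n : ℕ) (increasing : ∀ {i j} → i < j → j < n → F i < F j)
           (bounded : ∀ {i} → i < n → F i < n) where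

    private
      lower : ∀ {i} → i < n → i ≤ F i
      lower {zero} _ = z≤n
      lower {suc i} 1+i<n = ≤-<-trans (lower (<-trans (n<1+n i) 1+i<n)) (increasing (n<1+n i) 1+i<n)

      spread : ∀ k {i} → i + k < n → F i + k ≤ F (i + k)
      spread zero {i} _ rewrite +-identityʳ i | +-identityʳ (F i) = ≤-refl
      spread (suc k) {i} i+1+k<n rewrite +-suc (F i) k | +-suc i k =
        ≤-<-trans (spread k (<-trans (n<1+n (i + k)) i+1+k<n)) (increasing (n<1+n (i + k)) i+1+k<n)

    strictlyIncreasing⇒id : ∀ {i} → i < n → F i ≡ i
    strictlyIncreasing⇒id {i} i<n = ≤-antisym (≤-pred (+-cancelʳ-< (n ∸ suc i) (F i) (suc i) upper)) (lower i<n)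
      where
      i+k+1≡n : suc (i + (n ∸ suc i)) ≡ n
      i+k+1≡n = m+[n∸m]≡n i<n
      upper : F i + (n ∸ suc i) < suc i + (n ∸ suc i)
      upper = ≤-<-trans (spread (n ∸ suc i) (≤-reflexive i+k+1≡n))
                        (<-≤-trans (bounded (≤-reflexive i+k+1≡n)) (≤-reflexive (sym i+k+1≡n)))

  zeroExtend : ∀ {n} → (Fin n → ℕ) → ℕ → ℕ
  zeroExtend {n} g k with k <? n
  ... | yes k<n = g (fromℕ< k<n)
  ... | no _ = 0

  zeroExtend-< : ∀ {n} (g : Fin n → ℕ) {k} (k<n : k < n) → zeroExtend g k ≡ g (fromℕ< k<n)
  zeroExtend-< {n} g {k} k<n with k <? n
  ... | yes _ = refl
  ... | no k≮n = ⊥-elim (k≮n k<n)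

  zeroExtend-toℕ : ∀ {n} (g : Fin n → ℕ) (i : Fin n) → zeroExtend g (toℕ i) ≡ g i
  zeroExtend-toℕ g i = trans (zeroExtend-< g (toℕ<n i)) (cong g (fromℕ<-toℕ i (toℕ<n i)))

  strictlyIncreasing⇒idᶠ : ∀ {n} (f : Fin n → Fin n) → (∀ {i j} → toℕ i < toℕ j → toℕ (f i) < toℕ (f j)) → f ≗ (λ i → i)
  strictlyIncreasing⇒idᶠ {n} f increasing i =
    toℕ-injective (trans (sym (zeroExtend-toℕ g i)) (strictlyIncreasing⇒id (zeroExtend g) n increasingℕ boundedℕ (toℕ<n i)))
    where
    g : Fin n → ℕ
    g = toℕ ∘ f
    increasingℕ : ∀ {a b} → a < b → b < n → zeroExtend g a < zeroExtend g b
    increasingℕ {a} {b} a<b b<n rewrite zeroExtend-< g (<-trans a<b b<n) | zeroExtend-< g b<n =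
      increasing (subst₂ _<_ (sym (toℕ-fromℕ< (<-trans a<b b<n))) (sym (toℕ-fromℕ< b<n)) a<b)
    boundedℕ : ∀ {a} → a < n → zeroExtend g a < n
    boundedℕ a<n rewrite zeroExtend-< g a<n = toℕ<n _

  injective⇒surjective : ∀ {n} (f : Fin n → Fin n) → (∀ {i j} → f i ≡ f j → i ≡ j) → ∀ k → ∃ λ i → f i ≡ k
  injective⇒surjective {suc n} f injective k with any? (λ i → f i ≟ k)
  ... | yes hit = hit
  ... | no miss with i , j , i<j , e ← pigeonhole (n<1+n n) (λ i → punchOut {i = k} {j = f i} (miss ∘ (i ,_) ∘ sym))
    = ⊥-elim (<-irrefl (cong toℕ (injective (punchOut-injective {i = k} _ _ e))) i<j)

  module _ (a b δ : ℕ → ℕ) (n : ℕ) (a-step : ∀ k → a (suc k) ≡ a k + δ k)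
           (b-step : ∀ k → suc k < n → b k + δ k ≤ b (suc k)) where

    gap-nondecreasing : ∀ {k l} → k ≤ l → l < n → b k + a l ≤ b l + a k
    gap-nondecreasing {l = zero} z≤n _ = ≤-refl
    gap-nondecreasing {k} {suc l} k≤1+l 1+l<n with m≤n⇒m<n∨m≡n k≤1+l
    ... | inj₂ refl = ≤-refl
    ... | inj₁ k<1+l = begin
      b k + a (suc l)         ≡⟨ cong (b k ℕ.+_) (a-step l) ⟩
      b k + (a l + δ l)       ≡⟨ +-assoc (b k) (a l) (δ l) ⟨
      b k + a l + δ l         ≤⟨ +-monoˡ-≤ (δ l) (gap-nondecreasing (≤-pred k<1+l) (<-trans (n<1+n l) 1+l<n)) ⟩
      b l + a k + δ l         ≡⟨ +-comm-middle (b l) (a k) (δ l) ⟩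
      b l + δ l + a k         ≤⟨ +-monoˡ-≤ (a k) (b-step l 1+l<n) ⟩
      b (suc l) + a k         ∎
      where
      open ≤-Reasoning
      +-comm-middle : ∀ x y z → x + y + z ≡ x + z + y
      +-comm-middle = solve-∀

  least : (ℕ → Bool) → ℕ → ℕ
  least P zero = 0
  least P (suc n) = if P 0 then 0 else suc (least (P ∘ suc) n)

  least-satisfies : ∀ (P : ℕ → Bool) n {m} → P m ≡ true → m ≤ n → P (least P n) ≡ true
  least-satisfies P zero {zero} Pm _ = Pm
  least-satisfies P (suc n) {zero} Pm _ with P 0 in P0
  ... | true = P0
  ... | false = case Pm of λ ()
  least-satisfies P (suc n) {suc m} Pm (s≤s m≤n) with P 0 in P0
  ... | true = P0
  ... | false = least-satisfies (P ∘ suc) n Pm m≤n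

  least-minimal : ∀ (P : ℕ → Bool) n {m} → m < least P n → P m ≡ false
  least-minimal P (suc n) {zero} m<least with P 0 in P0
  least-minimal P (suc n) {zero} () | true
  ... | false = refl
  least-minimal P (suc n) {suc m} m<least with P 0 in P0
  least-minimal P (suc n) {suc m} () | true
  least-minimal P (suc n) {suc m} (s≤s m<least) | false = least-minimal (P ∘ suc) n m<least

  least≤ : ∀ (P : ℕ → Bool) n → least P n ≤ n
  least≤ P zero = z≤n
  least≤ P (suc n) with P 0
  ... | true = z≤n
  ... | false = s≤s (least≤ (P ∘ suc) n)

  least≤witness : ∀ (P : ℕ → Bool) n {m} → P m ≡ true → least P n ≤ m
  least≤witness P n {m} Pm = ≮⇒≥ λ m<least → case trans (sym Pm) (least-minimal P n m<least) of λ ()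

  argmax : (g : ℕ → ℕ) (n : ℕ) → ∃ λ i → i ≤ n × (∀ j → j ≤ n → g j ≤ g i)
  argmax g zero = 0 , z≤n , λ { zero _ → ≤-refl }
  argmax g (suc n) with i , i≤n , maximal ← argmax g n with ≤-total (g (suc n)) (g i)
  ... | inj₁ below = i , m≤n⇒m≤1+n i≤n , λ j j≤1+n → case m≤n⇒m<n∨m≡n j≤1+n of λ
        { (inj₁ (s≤s j≤n)) → maximal j j≤n ; (inj₂ refl) → below }
  ... | inj₂ above = suc n , ≤-refl , λ j j≤1+n → case m≤n⇒m<n∨m≡n j≤1+n of λ
        { (inj₁ (s≤s j≤n)) → ≤-trans (maximal j j≤n) above ; (inj₂ refl) → ≤-refl }

  module _ {A : Set} {P Q : A → Set} (P? : Decidable P) (Q? : Decidable Q) (P⇒Q : ∀ {x} → P x → Q x) where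

    length-filter-mono : ∀ xs → length (filter P? xs) ≤ length (filter Q? xs)
    length-filter-mono [] = z≤n
    length-filter-mono (x ∷ xs) with P? x | Q? x
    ... | yes _ | yes _ = s≤s (length-filter-mono xs)
    ... | yes p | no ¬q = ⊥-elim (¬q (P⇒Q p))
    ... | no _ | yes _ = m≤n⇒m≤1+n (length-filter-mono xs)
    ... | no _ | no _ = length-filter-mono xs

    length-filter-strict : ∀ {xs x} → x ∈ xs → ¬ P x → Q x → length (filter P? xs) < length (filter Q? xs)
    length-filter-strict {x ∷ xs} (here refl) ¬p q with P? x | Q? x
    ... | yes p | _ = ⊥-elim (¬p p)
    ... | no _ | yes _ = s≤s (length-filter-mono xs)
    ... | no _ | no ¬q = ⊥-elim (¬q q)
    length-filter-strict {y ∷ xs} (there x∈) ¬p q with P? y | Q? y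
    ... | yes _ | yes _ = s≤s (length-filter-strict x∈ ¬p q)
    ... | yes p | no ¬q = ⊥-elim (¬q (P⇒Q p))
    ... | no _ | yes _ = m≤n⇒m≤1+n (length-filter-strict x∈ ¬p q)
    ... | no _ | no _ = length-filter-strict x∈ ¬p q

  module SortedEnumeration {n} {_⊏_ : Fin n → Fin n → Set} (_⊏?_ : Decidable₂ _⊏_)
    (⊏-irrefl : ∀ {u} → ¬ u ⊏ u) (⊏-trans : ∀ {u v w} → u ⊏ v → v ⊏ w → u ⊏ w)
    (⊏-connex : ∀ {u v} → u ≢ v → u ⊏ v ⊎ v ⊏ u) where

    rankℕ : Fin n → ℕ
    rankℕ v = length (filter (_⊏? v) (allFin n))

    private
      rank<n : ∀ v → rankℕ v < n
      rank<n v = subst (rankℕ v <_) (length-tabulate (λ i → i)) (filter-notAll (_⊏? v) (allFin n) (lose (∈-allFin v) ⊏-irrefl))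

    rank : Fin n → Fin n
    rank v = fromℕ< (rank<n v)

    toℕ-rank : ∀ v → toℕ (rank v) ≡ rankℕ v
    toℕ-rank v = toℕ-fromℕ< (rank<n v)

    rank-mono : ∀ {u v} → u ⊏ v → toℕ (rank u) < toℕ (rank v)
    rank-mono {u} {v} u⊏v = subst₂ _<_ (sym (toℕ-rank u)) (sym (toℕ-rank v))
      (length-filter-strict (_⊏? u) (_⊏? v) (λ w⊏u → ⊏-trans w⊏u u⊏v) (∈-allFin u) ⊏-irrefl u⊏v)

    rank-injective : ∀ {u v} → rank u ≡ rank v → u ≡ v
    rank-injective {u} {v} e with u ≟ v
    ... | yes u≡v = u≡v
    ... | no u≢v with ⊏-connex u≢v
    ...   | inj₁ u⊏v = ⊥-elim (<-irrefl (cong toℕ e) (rank-mono u⊏v))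
    ...   | inj₂ v⊏u = ⊥-elim (<-irrefl (cong toℕ (sym e)) (rank-mono v⊏u))

    sorted : Fin n → Fin n
    sorted i = proj₁ (injective⇒surjective rank rank-injective i)

    rank-sorted : ∀ i → rank (sorted i) ≡ i
    rank-sorted i = proj₂ (injective⇒surjective rank rank-injective i)

    sorted-injective : ∀ {i j} → sorted i ≡ sorted j → i ≡ j
    sorted-injective {i} {j} e = trans (sym (rank-sorted i)) (trans (cong rank e) (rank-sorted j))

    sorted-surjective : ∀ v → ∃ λ i → sorted i ≡ v
    sorted-surjective v = rank v , rank-injective (rank-sorted (rank v))

    sorted-increasing : ∀ {i j} → toℕ i < toℕ j → sorted i ⊏ sorted j
    sorted-increasing {i} {j} i<j with sorted i ≟ sorted j
    ... | yes e = ⊥-elim (<-irrefl (cong toℕ (sorted-injective e)) i<j)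
    ... | no ≢ with ⊏-connex ≢
    ...   | inj₁ i⊏j = i⊏j
    ...   | inj₂ j⊏i = ⊥-elim (<-asym i<j (subst₂ _<_ (cong toℕ (rank-sorted j)) (cong toℕ (rank-sorted i)) (rank-mono j⊏i)))

    sorted-reflects : ∀ {i j} → sorted i ⊏ sorted j → toℕ i < toℕ j
    sorted-reflects {i} {j} i⊏j = subst₂ _<_ (cong toℕ (rank-sorted i)) (cong toℕ (rank-sorted j)) (rank-mono i⊏j)

    sorted-unique : (y : Fin n → Fin n) → (∀ {i j} → toℕ i < toℕ j → y i ⊏ y j) → y ≗ sorted
    sorted-unique y increasing i =
      rank-injective (trans (strictlyIncreasing⇒idᶠ (rank ∘ y) (rank-mono ∘ increasing) i) (sym (rank-sorted i)))

  -- Descents of a sequence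

  module Descents (s : ℕ → ℕ) where

    isDescent : ℕ → Bool
    isDescent k = s (suc k) <ᵇ s k

    ascents : ℕ → ℕ
    ascents zero = 0
    ascents (suc m) = ascents m + (if isDescent m then 0 else 1)

    descents : ℕ → ℕ
    descents m = length (filterᵇ isDescent (upTo m))

    ascents+descents : ∀ m → ascents m + descents m ≡ m
    ascents+descents zero = refl
    ascents+descents (suc m) = begin
      ascents m + a + length (filterᵇ isDescent (upTo (suc m)))
        ≡⟨ cong (λ xs → ascents m + a + length xs) (filterᵇ-upTo-suc isDescent m) ⟩
      ascents m + a + length (filterᵇ isDescent (upTo m) ++ (if isDescent m then m ∷ [] else []))
        ≡⟨ cong (ascents m + a ℕ.+_) (length-++ (filterᵇ isDescent (upTo m))) ⟩
      ascents m + a + (descents m + length (if isDescent m then m ∷ [] else []))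
        ≡⟨ +-cong₂-shuffle (ascents m) a (descents m) _ ⟩
      (ascents m + descents m) + (a + length (if isDescent m then m ∷ [] else []))
        ≡⟨ cong₂ _+_ (ascents+descents m) one-step ⟩
      m + 1
        ≡⟨ +-comm m 1 ⟩
      suc m ∎
      where
      open ≡-Reasoning
      a : ℕ
      a = if isDescent m then 0 else 1
      +-cong₂-shuffle : ∀ w x y z → w + x + (y + z) ≡ (w + y) + (x + z)
      +-cong₂-shuffle = solve-∀
      one-step : a + length (if isDescent m then m ∷ [] else []) ≡ 1
      one-step with isDescent m
      ... | true = refl
      ... | false = refl

    ascents-mono : ∀ {i j} → i ≤ j → ascents i ≤ ascents j
    ascents-mono {j = zero} z≤n = ≤-refl
    ascents-mono {i} {suc j} i≤1+j with m≤n⇒m<n∨m≡n i≤1+j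
    ... | inj₂ refl = ≤-refl
    ... | inj₁ i<1+j = ≤-trans (ascents-mono (≤-pred i<1+j)) (m≤m+n (ascents j) _)

    ascents-flat⇒decreasing : ∀ {i j} → i < j → ascents i ≡ ascents j → s j < s i
    ascents-flat⇒decreasing {i} {suc j} i<1+j flat with isDescent j in descent
    ... | false = ⊥-elim (<-irrefl flat (≤-trans (s≤s (ascents-mono (≤-pred i<1+j))) (≤-reflexive (+-comm 1 (ascents j)))))
    ... | true with m≤n⇒m<n∨m≡n (≤-pred i<1+j)
    ...   | inj₂ refl = <ᵇ-true⇒< descent
    ...   | inj₁ i<j = <-trans (<ᵇ-true⇒< descent) (ascents-flat⇒decreasing i<j (trans flat (+-identityʳ (ascents j))))

    descentWeight : ℕ → ℕ → ℕ
    descentWeight N m = sum (map (λ k → N ∸ suc k) (filterᵇ isDescent (upTo m)))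

    private
      colourSum : ℕ → ℕ
      colourSum m = sum (map (suc ∘ ascents) (upTo m))

      invariant : ∀ N m → m ≤ N →
        colourSum m + descentWeight N m + (N ∸ m) * ascents m ≡ m + sum (map (λ k → N ∸ suc k) (upTo m))
      invariant N zero _ = *-zeroʳ N
      invariant N (suc m) m<N = begin
        colourSum (suc m) + descentWeight N (suc m) + r * ascents (suc m)
          ≡⟨ cong₂ (λ x y → x + y + r * ascents (suc m)) (sum-map-upTo-suc (suc ∘ ascents) m)
                                                        (sum-map-filterᵇ-upTo-suc (λ k → N ∸ suc k) isDescent m) ⟩
        (colourSum m + suc a) + (descentWeight N m + (if isDescent m then r else 0)) + r * (a + (if isDescent m then 0 else 1))
          ≡⟨ step (isDescent m) ⟩
        colourSum m + descentWeight N m + suc r * a + suc r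
          ≡⟨ cong (λ x → colourSum m + descentWeight N m + x * a + suc r) (∸≡suc∸suc m<N) ⟨
        colourSum m + descentWeight N m + (N ∸ m) * a + suc r
          ≡⟨ cong (_+ suc r) (invariant N m (<⇒≤ m<N)) ⟩
        m + sum (map (λ k → N ∸ suc k) (upTo m)) + suc r
          ≡⟨ +-suc-shuffle m _ r ⟩
        suc m + (sum (map (λ k → N ∸ suc k) (upTo m)) + r)
          ≡⟨ cong (suc m ℕ.+_) (sum-map-upTo-suc (λ k → N ∸ suc k) m) ⟨
        suc m + sum (map (λ k → N ∸ suc k) (upTo (suc m))) ∎
        where
        open ≡-Reasoning
        a : ℕ
        a = ascents m
        r : ℕ
        r = N ∸ suc m
        +-suc-shuffle : ∀ x y z → x + y + suc z ≡ suc x + (y + z)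
        +-suc-shuffle = solve-∀
        on-descent : ∀ w x y z → w + suc x + (y + z) + z * (x + 0) ≡ w + y + suc z * x + suc z
        on-descent = solve-∀
        on-ascent : ∀ w x y z → w + suc x + (y + 0) + z * (x + 1) ≡ w + y + suc z * x + suc z
        on-ascent = solve-∀
        step : ∀ b → colourSum m + suc a + (descentWeight N m + (if b then r else 0)) + r * (a + (if b then 0 else 1))
                     ≡ colourSum m + descentWeight N m + suc r * a + suc r
        step true = on-descent (colourSum m) a (descentWeight N m) r
        step false = on-ascent (colourSum m) a (descentWeight N m) r

      descentWeight-last : ∀ N → descentWeight N N ≡ descentWeight N (N ∸ 1)
      descentWeight-last zero = refl
      descentWeight-last (suc n) =
        trans (sum-map-filterᵇ-upTo-suc (λ k → suc n ∸ suc k) isDescent n)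
              (trans (cong (descentWeight (suc n) n ℕ.+_) (vanishes (isDescent n))) (+-identityʳ _))
        where
        vanishes : ∀ b → (if b then n ∸ n else 0) ≡ 0
        vanishes true = n∸n≡0 n
        vanishes false = refl

    -- an ascent at k is counted by ascents i for the N ∸ suc k positions i > k, so the two
    -- sums together weigh every k < N by N ∸ suc k
    colourSum+descentWeight : ∀ N → sum (map (suc ∘ ascents) (upTo N)) + descentWeight N (N ∸ 1) ≡ suc N C 2
    colourSum+descentWeight N = begin
      colourSum N + descentWeight N (N ∸ 1)                  ≡⟨ cong (colourSum N ℕ.+_) (descentWeight-last N) ⟨
      colourSum N + descentWeight N N                        ≡⟨ +-identityʳ _ ⟨
      colourSum N + descentWeight N N + 0                    ≡⟨ cong (λ x → colourSum N + descentWeight N N + x * ascents N) (n∸n≡0 N) ⟨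
      colourSum N + descentWeight N N + (N ∸ N) * ascents N  ≡⟨ invariant N N ≤-refl ⟩
      N + sum (map (λ k → N ∸ suc k) (upTo N))               ≡⟨ cong₂ _+_ (nC1≡n N) (sym (∑[N∸suc-k]≡NC2 N)) ⟨
      N C 1 + N C 2                                          ≡⟨ nCk+nC[k+1]≡[n+1]C[k+1] N 1 ⟩
      suc N C 2                                              ∎
      where
      open ≡-Reasoning

  entries : ∀ {d} → (Fin d → Fin d) → ℕ → ℕ
  entries σ k = at (word σ) (suc k)

  entries-toℕ : ∀ {d} (σ : Fin d → Fin d) (i : Fin d) → entries σ (toℕ i) ≡ suc (toℕ (σ i))
  entries-toℕ {d} σ i =
    trans (cong (λ w → at w (suc (toℕ i))) (map-tabulate (λ j → j) (λ j → suc (toℕ (σ j))))) (at-tabulate _ i)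
    where
    at-tabulate : ∀ {n} (f : Fin n → ℕ) (i : Fin n) → at (tabulate f) (suc (toℕ i)) ≡ f i
    at-tabulate f Fin.zero = refl
    at-tabulate f (Fin.suc Fin.zero) = refl
    at-tabulate {suc n} f (Fin.suc (Fin.suc i)) = at-tabulate (f ∘ Fin.suc) (Fin.suc i)

  entries-fromℕ< : ∀ {d} (σ : Fin d → Fin d) {k} (k<d : k < d) → entries σ k ≡ suc (toℕ (σ (fromℕ< k<d)))
  entries-fromℕ< σ k<d = trans (cong (entries σ) (sym (toℕ-fromℕ< k<d))) (entries-toℕ σ (fromℕ< k<d))

  module _ {d} (σ : Fin d → Fin d) where
    open Descents (entries σ)

    Des≡ : Des σ ≡ map suc (filterᵇ isDescent (upTo (d ∸ 1)))
    Des≡ = filterᵇ-map-suc (λ j → at (word σ) (suc j) <ᵇ at (word σ) j) (upTo (d ∸ 1))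

    des≡descents : des σ ≡ descents (d ∸ 1)
    des≡descents = trans (cong length Des≡) (length-map suc (filterᵇ isDescent (upTo (d ∸ 1))))

    colourSum+comaj : sum (map (suc ∘ ascents) (upTo d)) + comaj σ ≡ suc d C 2
    colourSum+comaj = trans (cong (sum (map (suc ∘ ascents) (upTo d)) ℕ.+_) comaj≡descentWeight)
                            (colourSum+descentWeight d)
      where
      comaj≡descentWeight : comaj σ ≡ descentWeight d (d ∸ 1)
      comaj≡descentWeight = trans (cong (sum ∘ map (d ∸_)) Des≡) (cong sum (sym (map-∘ (filterᵇ isDescent (upTo (d ∸ 1))))))

  module _ {d} (σ : Fin d → Fin d) where
    open Descents (entries σ)

    increasing⇒des≡0 : (∀ {i j} → toℕ i < toℕ j → toℕ (σ i) < toℕ (σ j)) → des σ ≡ 0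
    increasing⇒des≡0 increasing = trans (cong length (Des≡ σ)) (cong (length ∘ map suc) (filterᵇ-none isDescent ascent))
      where
      ascent : ∀ {k} → k ∈ upTo (d ∸ 1) → isDescent k ≡ false
      ascent {k} k∈ = ≮⇒<ᵇ-false λ lt → <-asym lt (subst₂ _<_ (sym (entries-fromℕ< σ k<d)) (sym (entries-fromℕ< σ 1+k<d))
        (s≤s (increasing (subst₂ _<_ (sym (toℕ-fromℕ< k<d)) (sym (toℕ-fromℕ< 1+k<d)) (n<1+n k)))))
        where
        1+k<d : suc k < d
        1+k<d = <∸1⇒1+< (∈-upTo⁻ k∈)
        k<d : k < d
        k<d = <-trans (n<1+n k) 1+k<d

    des≡0⇒increasing : (∀ {i j} → σ i ≡ σ j → i ≡ j) → des σ ≡ 0 → ∀ {i j} → toℕ i < toℕ j → toℕ (σ i) < toℕ (σ j)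
    des≡0⇒increasing injective none {i} {j} i<j =
      ≤-pred (subst₂ _<_ (entries-toℕ σ i) (entries-toℕ σ j) (chain i<j (toℕ<n j)))
      where
      step : ∀ {k} → suc k < d → entries σ k < entries σ (suc k)
      step {k} 1+k<d = ≤∧≢⇒< (≮⇒≥ (λ lt → case trans (sym (<⇒<ᵇ-true lt)) no-descent of λ ())) distinct
        where
        no-descent : isDescent k ≡ false
        no-descent = length-filterᵇ≡0⁻ isDescent (trans (sym (des≡descents σ)) none) (∈-upTo⁺ (<⇒≤∸1 1+k<d))
        k<d : k < d
        k<d = <-trans (n<1+n k) 1+k<d
        distinct : entries σ k ≢ entries σ (suc k)
        distinct e = 1+n≢n (sym (trans (sym (toℕ-fromℕ< k<d))
          (trans (cong toℕ (injective (toℕ-injective (suc-injective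
            (trans (sym (entries-fromℕ< σ k<d)) (trans e (entries-fromℕ< σ 1+k<d))))))) (toℕ-fromℕ< 1+k<d))))
      chain : ∀ {a b} → a < b → b < d → entries σ a < entries σ b
      chain {a} {suc b} a<1+b 1+b<d with m≤n⇒m<n∨m≡n (≤-pred a<1+b)
      ... | inj₂ refl = step 1+b<d
      ... | inj₁ a<b = <-trans (chain a<b (<-trans (n<1+n b) 1+b<d)) (step 1+b<d)

  des≡0⇒comaj≡0 : ∀ {d} (σ : Fin d → Fin d) → des σ ≡ 0 → comaj σ ≡ 0
  des≡0⇒comaj≡0 {d} σ none with Des σ | none
  ... | [] | _ = refl

  bools-distinct : Distinct _≡_ bools
  bools-distinct = ((λ ()) ∷ []) ∷ [] ∷ []

  bools-complete : ∀ b → b ∈ bools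
  bools-complete true = here refl
  bools-complete false = there (here refl)

  _≗₂_ : ∀ {d} → Orientation d → Orientation d → Set
  ρ ≗₂ ρ′ = Pointwise _≗_ ρ ρ′

  module IsOrientation {d} {adj : Graph d} {ρ : Orientation d} (o : isOrientationOf adj ρ ≡ true) where

    private
      cell : ∀ u v → ((adj u v ∧ (ρ u v xor ρ v u)) ∨ (not (adj u v) ∧ not (ρ u v))) ≡ true
      cell u v = allFin-true⁻ _ (allFin-true⁻ _ o u) v

    arc⇒edge : ∀ {u v} → ρ u v ≡ true → adj u v ≡ true
    arc⇒edge {u} {v} e with adj u v | ρ u v | cell u v
    ... | true | _ | _ = refl
    arc⇒edge () | false | false | _

    arc⇒¬arc : ∀ {u v} → ρ u v ≡ true → ρ v u ≡ false
    arc⇒¬arc {u} {v} e with adj u v | ρ u v | ρ v u | cell u v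
    ... | true | true | false | _ = refl
    arc⇒¬arc () | _ | false | _ | _

    edge⇒arc : ∀ {u v} → adj u v ≡ true → ρ u v ≡ false → ρ v u ≡ true
    edge⇒arc {u} {v} a e with adj u v | ρ u v | ρ v u | cell u v
    ... | true | false | true | _ = refl

  isOrientationOf-intro : ∀ {d} {adj : Graph d} {ρ : Orientation d} →
    (∀ u v → adj u v ≡ true → (ρ u v xor ρ v u) ≡ true) → (∀ u v → adj u v ≡ false → ρ u v ≡ false) →
    isOrientationOf adj ρ ≡ true
  isOrientationOf-intro {adj = adj} {ρ} on-edges off-edges =
    allFin-true⁺ _ λ u → allFin-true⁺ _ λ v → cell u v
    where
    cell : ∀ u v → ((adj u v ∧ (ρ u v xor ρ v u)) ∨ (not (adj u v) ∧ not (ρ u v))) ≡ true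
    cell u v with adj u v in a
    ... | true rewrite on-edges u v a = refl
    ... | false rewrite off-edges u v a = refl

  module _ {d} (ρ : Orientation d) where

    walk-step⁻ : ∀ {k u w} → walk ρ (suc k) u w ≡ true → ∃ λ v → ρ u v ≡ true × walk ρ k v w ≡ true
    walk-step⁻ {k} {u} {w} e with v , arc∧walk ← anyFin-true⁻ (λ v → ρ u v ∧ walk ρ k v w) e = v , ∧-true⁻ arc∧walk

    walk-step⁺ : ∀ {k u v w} → ρ u v ≡ true → walk ρ k v w ≡ true → walk ρ (suc k) u w ≡ true
    walk-step⁺ {k} {u} {v} {w} arc vw = anyFin-true⁺ (λ x → ρ u x ∧ walk ρ k x w) v (∧-true⁺ arc vw)

    module _ (key : Fin d → ℕ) (increasing : ∀ {u v} → ρ u v ≡ true → key u < key v) where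

      walk-nondecreasing : ∀ k {u w} → walk ρ k u w ≡ true → key u ≤ key w
      walk-nondecreasing zero e rewrite =ᶠ⇒≡ e = ≤-refl
      walk-nondecreasing (suc k) e with _ , arc , w ← walk-step⁻ {k} e =
        ≤-trans (<⇒≤ (increasing arc)) (walk-nondecreasing k w)

      walk-increasing : ∀ k {u w} → walk ρ (suc k) u w ≡ true → key u < key w
      walk-increasing k e with _ , arc , w ← walk-step⁻ {k} e =
        <-≤-trans (increasing arc) (walk-nondecreasing k w)

    ≺⇒walk : ∀ {u w} → (ρ ⊢ u ≺ w) ≡ true → ∃ λ k → walk ρ (suc k) u w ≡ true
    ≺⇒walk {u} {w} e with ⪯ , ≢ ← ∧-true⁻ e with any-true⁻ (λ k → walk ρ k u w) {upTo d} ⪯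
    ... | zero , _ , u=w = ⊥-elim (=ᶠ-false⇒≢ (not-true⁻ ≢) (=ᶠ⇒≡ u=w))
    ... | suc k , _ , walk = k , walk

    arc⇒≺ : ∀ {u v} → ρ u v ≡ true → u ≢ v → (ρ ⊢ u ≺ v) ≡ true
    arc⇒≺ {u} {v} arc u≢v =
      ∧-true⁺ (any-true⁺ (λ k → walk ρ k u v) (∈-upTo⁺ (two-vertices u v u≢v)) (walk-step⁺ {k = 0} arc (≡⇒=ᶠ {i = v} refl)))
              (cong not (≢⇒=ᶠ-false u≢v))
      where
      two-vertices : ∀ {n} (u v : Fin n) → u ≢ v → 1 < n
      two-vertices Fin.zero Fin.zero u≢v = ⊥-elim (u≢v refl)
      two-vertices Fin.zero (Fin.suc v) _ = s≤s (≤-<-trans z≤n (toℕ<n v))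
      two-vertices (Fin.suc u) _ _ = s≤s (≤-<-trans z≤n (toℕ<n u))

  isAcyclicOrientation-intro : ∀ {d} {adj : Graph d} {ρ : Orientation d} → isOrientationOf adj ρ ≡ true →
    (∀ k u → walk ρ (suc k) u u ≡ false) → isAcyclicOrientation adj ρ ≡ true
  isAcyclicOrientation-intro {d} {ρ = ρ} o no-closed-walk =
    ∧-true⁺ o (cong not (any-false⁺ (λ u → any (λ k → walk ρ k u u) (map suc (upTo d))) {allFin d} λ {u} _ →
                         any-false⁺ (λ k → walk ρ k u u) {map suc (upTo d)} (closed u)))
    where
    closed : ∀ u {k} → k ∈ map suc (upTo d) → walk ρ k u u ≡ false
    closed u k∈ with k , _ , refl ← ∈-map⁻ suc k∈ = no-closed-walk k u

  module IsLinearExtension {d} {ρ : Orientation d} {y : Fin d → Fin d} (le : isLinearExtension ρ y ≡ true) where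

    private
      bijective : isBijectionᵇ y ≡ true
      bijective = proj₁ (∧-true⁻ le)

    injective : ∀ {i j} → y i ≡ y j → i ≡ j
    injective {i} {j} e =
      =ᶠ⇒≡ (⇒ᵇ-true⁻ (allFin-true⁻ _ (allFin-true⁻ _ (proj₁ (∧-true⁻ bijective)) i) j) (≡⇒=ᶠ e))

    surjective : ∀ v → ∃ λ i → y i ≡ v
    surjective v with i , e ← anyFin-true⁻ _ (allFin-true⁻ _ (proj₂ (∧-true⁻ bijective)) v) = i , =ᶠ⇒≡ e

    respects-≺ : ∀ {i j} → (ρ ⊢ y i ≺ y j) ≡ true → toℕ i < toℕ j
    respects-≺ {i} {j} e =
      <ᵇ-true⇒< (⇒ᵇ-true⁻ (allFin-true⁻ _ (allFin-true⁻ _ (proj₂ (∧-true⁻ {isBijectionᵇ y} le)) i) j) e)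

  isLinearExtension-intro : ∀ {d} {ρ : Orientation d} {y : Fin d → Fin d} →
    (∀ {i j} → y i ≡ y j → i ≡ j) → (∀ v → ∃ λ i → y i ≡ v) →
    (∀ {i j} → (ρ ⊢ y i ≺ y j) ≡ true → toℕ i < toℕ j) → isLinearExtension ρ y ≡ true
  isLinearExtension-intro {ρ = ρ} {y} injective surjective respects-≺ =
    ∧-true⁺ (∧-true⁺ (allFin-true⁺ _ λ i → allFin-true⁺ (λ j → (y i =ᶠ y j) ⇒ᵇ (i =ᶠ j)) λ j →
                        ⇒ᵇ-true⁺ λ e → ≡⇒=ᶠ (injective (=ᶠ⇒≡ e)))
                     (allFin-true⁺ _ λ v → let i , e = surjective v in anyFin-true⁺ (λ i → y i =ᶠ v) i (≡⇒=ᶠ e)))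
            (allFin-true⁺ _ λ i → allFin-true⁺ (λ j → (ρ ⊢ y i ≺ y j) ⇒ᵇ (toℕ i <ᵇ toℕ j)) λ j →
               ⇒ᵇ-true⁺ λ e → <⇒<ᵇ-true (respects-≺ e))

  module _ {d m} {adj : Graph d} {c : Fin d → Fin m} where

    isProperColoring⁻ : isProperColoring adj c ≡ true → ∀ {u v} → adj u v ≡ true → c u ≢ c v
    isProperColoring⁻ h {u} {v} a =
      =ᶠ-false⇒≢ (not-true⁻ (⇒ᵇ-true⁻ (allFin-true⁻ _ (allFin-true⁻ _ h u) v) a))

    isProperColoring⁺ : (∀ {u v} → adj u v ≡ true → c u ≢ c v) → isProperColoring adj c ≡ true
    isProperColoring⁺ h =
      allFin-true⁺ _ λ u → allFin-true⁺ (λ v → adj u v ⇒ᵇ not (c u =ᶠ c v)) λ v →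
        ⇒ᵇ-true⁺ λ a → cong not (≢⇒=ᶠ-false (h a))

  module NaturalLabeling {d} {ρ : Orientation d} {ω : Fin d → Fin d} (nat : IsNaturalLabeling ρ ω) where

    injective : ∀ {x y} → ω x ≡ ω y → x ≡ y
    injective = proj₁ nat _ _

    surjective : ∀ i → ∃ λ x → ω x ≡ i
    surjective = proj₁ (proj₂ nat)

    monotone : ∀ {x y} → (ρ ⊢ x ≺ y) ≡ true → toℕ (ω x) < toℕ (ω y)
    monotone = proj₂ (proj₂ nat) _ _

  module _ {d : ℕ} where

    walk-cong : {ρ ρ′ : Orientation d} → ρ ≗₂ ρ′ → ∀ k u w → walk ρ k u w ≡ walk ρ′ k u w
    walk-cong ρ≗ρ′ zero u w = refl
    walk-cong ρ≗ρ′ (suc k) u w = any-cong (λ v → cong₂ _∧_ (ρ≗ρ′ u v) (walk-cong ρ≗ρ′ k v w)) (allFin d)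

    isAcyclicOrientation-cong : (adj : Graph d) {ρ ρ′ : Orientation d} → ρ ≗₂ ρ′ →
                                isAcyclicOrientation adj ρ ≡ isAcyclicOrientation adj ρ′
    isAcyclicOrientation-cong adj ρ≗ρ′ = cong₂ (λ a b → a ∧ not b)
      (all-cong (λ u → all-cong (λ v → cong₂ (λ a b → (adj u v ∧ (a xor b)) ∨ (not (adj u v) ∧ not a))
                                              (ρ≗ρ′ u v) (ρ≗ρ′ v u)) (allFin d)) (allFin d))
      (any-cong (λ u → any-cong (λ k → walk-cong ρ≗ρ′ k u u) (map suc (upTo d))) (allFin d))

    isLinearExtension-cong : (ρ : Orientation d) {y y′ : Fin d → Fin d} → y ≗ y′ →
                             isLinearExtension ρ y ≡ isLinearExtension ρ y′
    isLinearExtension-cong ρ y≗y′ = cong₂ _∧_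
      (cong₂ _∧_ (all-cong (λ i → all-cong (λ j → cong₂ (λ a b → (a =ᶠ b) ⇒ᵇ (i =ᶠ j)) (y≗y′ i) (y≗y′ j)) (allFin d)) (allFin d))
                 (all-cong (λ v → any-cong (λ i → cong (_=ᶠ v) (y≗y′ i)) (allFin d)) (allFin d)))
      (all-cong (λ i → all-cong (λ j → cong₂ (λ a b → (ρ ⊢ a ≺ b) ⇒ᵇ (toℕ i <ᵇ toℕ j)) (y≗y′ i) (y≗y′ j)) (allFin d)) (allFin d))

    isProperColoring-cong : ∀ {m} (adj : Graph d) {c c′ : Fin d → Fin m} → c ≗ c′ →
                            isProperColoring adj c ≡ isProperColoring adj c′
    isProperColoring-cong adj c≗c′ =
      all-cong (λ u → all-cong (λ v → cong₂ (λ a b → adj u v ⇒ᵇ not (a =ᶠ b)) (c≗c′ u) (c≗c′ v)) (allFin d)) (allFin d)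

    ≗₂-sym : {ρ ρ′ : Orientation d} → ρ ≗₂ ρ′ → ρ′ ≗₂ ρ
    ≗₂-sym ρ≗ρ′ u v = sym (ρ≗ρ′ u v)

    acyclicOrientations-distinct : (adj : Graph d) → Distinct _≗₂_ (acyclicOrientations adj)
    acyclicOrientations-distinct adj = AllPairsₚ.filter⁺ (T? ∘ isAcyclicOrientation adj)
      (allFuns-distinct d (allFuns-distinct d bools-distinct))

    acyclicOrientations-complete : (adj : Graph d) {ρ : Orientation d} → isAcyclicOrientation adj ρ ≡ true →
                                   ∃ λ ρ′ → ρ′ ∈ acyclicOrientations adj × ρ ≗₂ ρ′
    acyclicOrientations-complete adj {ρ} acyclic =
      filterᵇ-complete (isAcyclicOrientation adj) (isAcyclicOrientation-cong adj) {xs = allFuns d (allFuns d bools)} acyclic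
        (allFuns-complete {R = _≗_} d ρ λ u → allFuns-complete {R = _≡_} d (ρ u) λ v → bools-complete (ρ u v))

    ∈-acyclicOrientations⁻ : {adj : Graph d} {ρ : Orientation d} → ρ ∈ acyclicOrientations adj →
                             isAcyclicOrientation adj ρ ≡ true
    ∈-acyclicOrientations⁻ {adj} ρ∈ = proj₂ (∈-filterᵇ⁻ (isAcyclicOrientation adj) {allFuns d (allFuns d bools)} ρ∈)

    linearExtensions-distinct : (ρ : Orientation d) → Distinct _≗_ (linearExtensions ρ)
    linearExtensions-distinct ρ = AllPairsₚ.filter⁺ (T? ∘ isLinearExtension ρ)
      (allFuns-distinct d (allFin⁺ d))

    linearExtensions-complete : (ρ : Orientation d) {y : Fin d → Fin d} → isLinearExtension ρ y ≡ true →
                                ∃ λ y′ → y′ ∈ linearExtensions ρ × y ≗ y′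
    linearExtensions-complete ρ {y} le =
      filterᵇ-complete (isLinearExtension ρ) (isLinearExtension-cong ρ) {xs = allFuns d (allFin d)} le
        (allFuns-complete {R = _≡_} d y (∈-allFin ∘ y))

    ∈-linearExtensions⁻ : {ρ : Orientation d} {y : Fin d → Fin d} → y ∈ linearExtensions ρ →
                          isLinearExtension ρ y ≡ true
    ∈-linearExtensions⁻ {ρ} y∈ = proj₂ (∈-filterᵇ⁻ (isLinearExtension ρ) {allFuns d (allFin d)} y∈)

    properColorings-distinct : (adj : Graph d) (m : ℕ) → Distinct _≗_ (properColorings adj m)
    properColorings-distinct adj m = AllPairsₚ.filter⁺ (T? ∘ isProperColoring adj)
      (allFuns-distinct d (allFin⁺ m))

    properColorings-complete : (adj : Graph d) {m : ℕ} {c : Fin d → Fin m} → isProperColoring adj c ≡ true →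
                               ∃ λ c′ → c′ ∈ properColorings adj m × c ≗ c′
    properColorings-complete adj {m} {c} proper =
      filterᵇ-complete (isProperColoring adj) (isProperColoring-cong adj) {xs = allFuns d (allFin m)} proper
        (allFuns-complete {R = _≡_} d c (∈-allFin ∘ c))

    ∈-properColorings⁻ : {adj : Graph d} {m : ℕ} {c : Fin d → Fin m} → c ∈ properColorings adj m →
                         isProperColoring adj c ≡ true
    ∈-properColorings⁻ {adj} {m} c∈ = proj₂ (∈-filterᵇ⁻ (isProperColoring adj) {allFuns d (allFin m)} c∈)

  module _ {d} (ρ : Orientation d) where

    walk-snoc⁺ : ∀ k {u x w} → walk ρ k u x ≡ true → ρ x w ≡ true → walk ρ (suc k) u w ≡ true
    walk-snoc⁺ zero {u} {w = w} u=x arc = walk-step⁺ ρ {k = 0} (subst (λ z → ρ z w ≡ true) (sym (=ᶠ⇒≡ u=x)) arc) (≡⇒=ᶠ {i = w} refl)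
    walk-snoc⁺ (suc k) w arc with _ , arc′ , w′ ← walk-step⁻ ρ {k} w = walk-step⁺ ρ {k = suc k} arc′ (walk-snoc⁺ k w′ arc)

    walk-snoc⁻ : ∀ k {u w} → walk ρ (suc k) u w ≡ true → ∃ λ x → walk ρ k u x ≡ true × ρ x w ≡ true
    walk-snoc⁻ zero {u} w with v , arc , v=w ← walk-step⁻ ρ {0} w =
      u , ≡⇒=ᶠ {i = u} refl , subst (λ z → ρ u z ≡ true) (=ᶠ⇒≡ v=w) arc
    walk-snoc⁻ (suc k) w with v , arc , w′ ← walk-step⁻ ρ {suc k} w with x , w″ , arc′ ← walk-snoc⁻ k w′ =
      x , walk-step⁺ ρ {k = k} arc w″ , arc′

    walk⇒sequence : ∀ k {u w} → walk ρ k u w ≡ true →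
      ∃ λ (f : ℕ → Fin d) → f 0 ≡ u × f k ≡ w × (∀ i → i < k → ρ (f i) (f (suc i)) ≡ true)
    walk⇒sequence zero {u} u=w = (λ _ → u) , refl , =ᶠ⇒≡ u=w , λ _ ()
    walk⇒sequence (suc k) {u} w with v , arc , w′ ← walk-step⁻ ρ {k} w with f , f0 , fk , arcs ← walk⇒sequence k w′ =
      g , refl , fk , g-arcs
      where
      g : ℕ → Fin d
      g zero = u
      g (suc i) = f i
      g-arcs : ∀ i → i < suc k → ρ (g i) (g (suc i)) ≡ true
      g-arcs zero _ = subst (λ z → ρ u z ≡ true) (sym f0) arc
      g-arcs (suc i) (s≤s i<k) = arcs i i<k

  path⇒walk : ∀ {d} (adj : Graph d) k (f : Fin (suc k) → Fin d) →
    (∀ (i : Fin k) → adj (f (inject₁ i)) (f (Fin.suc i)) ≡ true) → walk adj k (f Fin.zero) (f (fromℕ k)) ≡ true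
  path⇒walk adj zero f edges = ≡⇒=ᶠ {i = f Fin.zero} refl
  path⇒walk adj (suc k) f edges = walk-step⁺ adj {k = k} (edges Fin.zero) (path⇒walk adj k (f ∘ Fin.suc) (edges ∘ Fin.suc))

  colourOrientation : ∀ {d m} → Graph d → (Fin d → Fin m) → Orientation d
  colourOrientation adj c u v = adj u v ∧ (toℕ (c u) <ᵇ toℕ (c v))

  module _ {d m} {adj : Graph d} (simple : IsSimple adj) {c : Fin d → Fin m} (proper : isProperColoring adj c ≡ true) where

    colourOrientation-increasing : ∀ {u v} → colourOrientation adj c u v ≡ true → toℕ (c u) < toℕ (c v)
    colourOrientation-increasing arc = <ᵇ-true⇒< (proj₂ (∧-true⁻ arc))

    colourOrientation-acyclic : isAcyclicOrientation adj (colourOrientation adj c) ≡ true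
    colourOrientation-acyclic =
      isAcyclicOrientation-intro {adj = adj} (isOrientationOf-intro {adj = adj} {ρ = colourOrientation adj c} on-edges off-edges) no-closed-walk
      where
      on-edges : ∀ u v → adj u v ≡ true → (colourOrientation adj c u v xor colourOrientation adj c v u) ≡ true
      on-edges u v edge rewrite edge | trans (proj₁ simple v u) edge with <-cmp (toℕ (c u)) (toℕ (c v))
      ... | tri< lt _ _ rewrite <⇒<ᵇ-true lt | ≮⇒<ᵇ-false (<⇒≯ lt) = refl
      ... | tri> _ _ gt rewrite <⇒<ᵇ-true gt | ≮⇒<ᵇ-false (<⇒≯ gt) = refl
      ... | tri≈ _ same _ = ⊥-elim (isProperColoring⁻ {adj = adj} {c = c} proper edge (toℕ-injective same))
      off-edges : ∀ u v → adj u v ≡ false → colourOrientation adj c u v ≡ false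
      off-edges u v ¬edge rewrite ¬edge = refl
      no-closed-walk : ∀ k u → walk (colourOrientation adj c) (suc k) u u ≡ false
      no-closed-walk k u with walk (colourOrientation adj c) (suc k) u u in closed
      ... | true = ⊥-elim (<-irrefl refl (walk-increasing (colourOrientation adj c) (toℕ ∘ c) colourOrientation-increasing k closed))
      ... | false = refl

  -- colour classes in increasing order, each in decreasing ω-order: inside a class every step is a descent
  ColourOrder : ∀ {d} → (Fin d → ℕ) → (Fin d → Fin d) → Fin d → Fin d → Set
  ColourOrder key ω u v = key u < key v ⊎ (key u ≡ key v × toℕ (ω v) < toℕ (ω u))

  module _ {d} (key : Fin d → ℕ) (ω : Fin d → Fin d) where

    colourOrder? : Decidable₂ (ColourOrder key ω)
    colourOrder? u v = (key u <? key v) ⊎-dec ((key u ℕ.≟ key v) ×-dec (toℕ (ω v) <? toℕ (ω u)))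

    colourOrder-irrefl : ∀ {u} → ¬ ColourOrder key ω u u
    colourOrder-irrefl (inj₁ lt) = <-irrefl refl lt
    colourOrder-irrefl (inj₂ (_ , lt)) = <-irrefl refl lt

    colourOrder-trans : ∀ {u v w} → ColourOrder key ω u v → ColourOrder key ω v w → ColourOrder key ω u w
    colourOrder-trans (inj₁ a) (inj₁ b) = inj₁ (<-trans a b)
    colourOrder-trans (inj₁ a) (inj₂ (e , _)) = inj₁ (<-≤-trans a (≤-reflexive e))
    colourOrder-trans (inj₂ (e , _)) (inj₁ b) = inj₁ (≤-<-trans (≤-reflexive e) b)
    colourOrder-trans (inj₂ (e , a)) (inj₂ (e′ , b)) = inj₂ (trans e e′ , <-trans b a)

    colourOrder-connex : (∀ {u v} → ω u ≡ ω v → u ≡ v) → ∀ {u v} → u ≢ v → ColourOrder key ω u v ⊎ ColourOrder key ω v u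
    colourOrder-connex ω-injective {u} {v} u≢v with <-cmp (key u) (key v)
    ... | tri< lt _ _ = inj₁ (inj₁ lt)
    ... | tri> _ _ gt = inj₂ (inj₁ gt)
    ... | tri≈ _ e _ with <-cmp (toℕ (ω u)) (toℕ (ω v))
    ...   | tri< lt _ _ = inj₂ (inj₂ (sym e , lt))
    ...   | tri> _ _ gt = inj₁ (inj₂ (e , gt))
    ...   | tri≈ _ e′ _ = ⊥-elim (u≢v (ω-injective (toℕ-injective e′)))

    colourOrder-cong : ∀ {key′ : Fin d → ℕ} → key ≗ key′ → ∀ {u v} → ColourOrder key ω u v → ColourOrder key′ ω u v
    colourOrder-cong key≗ {u} {v} (inj₁ lt) = inj₁ (subst₂ _<_ (key≗ u) (key≗ v) lt)
    colourOrder-cong key≗ {u} {v} (inj₂ (same , ω-decreasing)) = inj₂ (trans (sym (key≗ u)) (trans same (key≗ v)) , ω-decreasing)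

    module ColourSorted (ω-injective : ∀ {u v} → ω u ≡ ω v → u ≡ v) =
      SortedEnumeration colourOrder? colourOrder-irrefl colourOrder-trans (colourOrder-connex ω-injective)

  module _ {d} {ρ : Orientation d} (key : Fin d → ℕ) (increasing : ∀ {u v} → ρ u v ≡ true → key u < key v)
           (ω : Fin d → Fin d) (ω-injective : ∀ {u v} → ω u ≡ ω v → u ≡ v) where
    open ColourSorted key ω ω-injective

    colourSorted-linearExtension : isLinearExtension ρ sorted ≡ true
    colourSorted-linearExtension = isLinearExtension-intro sorted-injective sorted-surjective λ ≺ →
      let k , walk = ≺⇒walk ρ ≺ in sorted-reflects (inj₁ (walk-increasing ρ key increasing k walk))

  -- The greedy colouring of a pair (ρ, σ)

  module GreedyColouring {d} {adj : Graph d} (irreflexive : ∀ u → adj u u ≡ false)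
    {ρ : Orientation d} (o : isOrientationOf adj ρ ≡ true)
    {ω : Fin d → Fin d} (nat : IsNaturalLabeling ρ ω)
    {y : Fin d → Fin d} (le : isLinearExtension ρ y ≡ true) where

    private
      module Y = IsLinearExtension {ρ = ρ} {y} le
      module Ω = NaturalLabeling {ρ = ρ} {ω} nat
    open IsOrientation {adj = adj} {ρ} o

    σ : Fin d → Fin d
    σ i = ω (y i)

    open Descents (entries σ) public

    position : Fin d → Fin d
    position v = proj₁ (Y.surjective v)

    y-position : ∀ v → y (position v) ≡ v
    y-position v = proj₂ (Y.surjective v)

    colour : Fin d → ℕ
    colour v = ascents (toℕ (position v))

    private
      arc⇒≺′ : ∀ {u v} → ρ u v ≡ true → (ρ ⊢ u ≺ v) ≡ true
      arc⇒≺′ {u} arc = arc⇒≺ ρ arc λ { refl → case trans (sym (arc⇒edge arc)) (irreflexive u) of λ () }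

    colour-y : ∀ i → colour (y i) ≡ ascents (toℕ i)
    colour-y i = cong (ascents ∘ toℕ) (Y.injective (y-position (y i)))

    sorted-by-colour : ∀ {i j} → toℕ i < toℕ j → ColourOrder colour ω (y i) (y j)
    sorted-by-colour {i} {j} i<j with m≤n⇒m<n∨m≡n (ascents-mono (<⇒≤ i<j))
    ... | inj₁ lt = inj₁ (subst₂ _<_ (sym (colour-y i)) (sym (colour-y j)) lt)
    ... | inj₂ eq = inj₂ (trans (colour-y i) (trans eq (sym (colour-y j))) ,
                          ≤-pred (subst₂ _<_ (entries-toℕ σ j) (entries-toℕ σ i) (ascents-flat⇒decreasing i<j eq)))

    arc⇒colour< : ∀ {u v} → ρ u v ≡ true → colour u < colour v
    arc⇒colour< {u} {v} arc with subst₂ (ColourOrder colour ω) (y-position u) (y-position v) (sorted-by-colour positions)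
      where
      positions : toℕ (position u) < toℕ (position v)
      positions = Y.respects-≺ (subst₂ (λ a b → (ρ ⊢ a ≺ b) ≡ true) (sym (y-position u)) (sym (y-position v)) (arc⇒≺′ arc))
    ... | inj₁ lt = lt
    ... | inj₂ (_ , ω-decreasing) = ⊥-elim (<-asym ω-decreasing (Ω.monotone (arc⇒≺′ arc)))

    colour-proper : ∀ {u v} → adj u v ≡ true → colour u ≢ colour v
    colour-proper {u} {v} edge same with ρ u v in arc
    ... | true = <-irrefl same (arc⇒colour< arc)
    ... | false = <-irrefl (sym same) (arc⇒colour< (edge⇒arc edge arc))

    ρ≡byColour : ∀ u v → ρ u v ≡ (adj u v ∧ (colour u <ᵇ colour v))
    ρ≡byColour u v with adj u v in edge | ρ u v in arc
    ... | false | true with () ← trans (sym (arc⇒edge arc)) edge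
    ... | false | false = refl
    ... | true | true = sym (<⇒<ᵇ-true (arc⇒colour< arc))
    ... | true | false = sym (≮⇒<ᵇ-false (<⇒≯ (arc⇒colour< (edge⇒arc edge arc))))

    colour≤ : ∀ v → colour v ≤ ascents (d ∸ 1)
    colour≤ v = ascents-mono (<⇒≤∸1 (toℕ<n (position v)))

    des≡d∸colours : des σ ≡ d ∸ suc (ascents (d ∸ 1))
    des≡d∸colours = begin
      des σ                                  ≡⟨ des≡descents σ ⟩
      descents (d ∸ 1)                       ≡⟨ m+n∸m≡n (ascents (d ∸ 1)) _ ⟨
      ascents (d ∸ 1) + descents (d ∸ 1) ∸ ascents (d ∸ 1) ≡⟨ cong (_∸ ascents (d ∸ 1)) (ascents+descents (d ∸ 1)) ⟩
      d ∸ 1 ∸ ascents (d ∸ 1)                ≡⟨ ∸-+-assoc d 1 (ascents (d ∸ 1)) ⟩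
      d ∸ suc (ascents (d ∸ 1))              ∎
      where open ≡-Reasoning

    greedy : Fin d → Fin (suc (ascents (d ∸ 1)))
    greedy v = fromℕ< (s≤s (colour≤ v))

    greedy-proper : isProperColoring adj greedy ≡ true
    greedy-proper = isProperColoring⁺ {adj = adj} {c = greedy} λ {u} {v} edge same →
      colour-proper edge (trans (sym (toℕ-fromℕ< (s≤s (colour≤ u)))) (trans (cong toℕ same) (toℕ-fromℕ< (s≤s (colour≤ v)))))

    module ChromaticBound {ξ} (minimal : ∀ m (c : Fin d → Fin m) → isProperColoring adj c ≡ true → ξ ≤ m) where

      χ≤colours : ξ ≤ suc (ascents (d ∸ 1))
      χ≤colours = minimal _ greedy greedy-proper

      des≤d∸χ : des σ ≤ d ∸ ξ
      des≤d∸χ = subst (_≤ d ∸ ξ) (sym des≡d∸colours) (∸-monoʳ-≤ d χ≤colours)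

      colour<χ : des σ ≡ d ∸ ξ → ∀ v → colour v < ξ
      colour<χ top v = <-≤-trans (s≤s (colour≤ v)) colours≤χ
        where
        colours≤d : suc (ascents (d ∸ 1)) ≤ d
        colours≤d = ≤-<-trans (≤-trans (m≤m+n _ _) (≤-reflexive (ascents+descents (d ∸ 1)))) (∸1< (toℕ<n v))
        colours≤χ : suc (ascents (d ∸ 1)) ≤ ξ
        colours≤χ = ∸-cancelʳ-≤ colours≤d (≤-reflexive (trans (sym top) des≡d∸colours))

      -- a listing sorted by a ξ-colouring c has c as its greedy colouring
      module SortedBy (c : Fin d → Fin ξ) (c-sorted : ∀ {i j} → toℕ i < toℕ j → ColourOrder (toℕ ∘ c) ω (y i) (y j)) where

        private
          b : ℕ → ℕ
          b = zeroExtend (toℕ ∘ c ∘ y)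

          b<χ : ∀ {l} → l < d → b l < ξ
          b<χ l<d rewrite zeroExtend-< (toℕ ∘ c ∘ y) l<d = toℕ<n _

          b-step : ∀ k → suc k < d → b k + (if isDescent k then 0 else 1) ≤ b (suc k)
          b-step k 1+k<d
            rewrite zeroExtend-< (toℕ ∘ c ∘ y) (<-trans (n<1+n k) 1+k<d) | zeroExtend-< (toℕ ∘ c ∘ y) 1+k<d
            with c-sorted (subst₂ _<_ (sym (toℕ-fromℕ< (<-trans (n<1+n k) 1+k<d))) (sym (toℕ-fromℕ< 1+k<d)) (n<1+n k))
          ... | inj₁ lt = ≤-trans (+-monoʳ-≤ _ (≤-if k)) (≤-trans (≤-reflexive (+-comm _ 1)) lt)
            where
            ≤-if : ∀ k → (if isDescent k then 0 else 1) ≤ 1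
            ≤-if k with isDescent k
            ... | true = z≤n
            ... | false = ≤-refl
          ... | inj₂ (same , ω-decreasing) = no-increment descent same
            where
            descent : isDescent k ≡ true
            descent = <⇒<ᵇ-true (subst₂ _<_ (sym (entries-fromℕ< σ 1+k<d)) (sym (entries-fromℕ< σ (<-trans (n<1+n k) 1+k<d)))
                                            (s≤s ω-decreasing))
            no-increment : ∀ {m n} → isDescent k ≡ true → m ≡ n → m + (if isDescent k then 0 else 1) ≤ n
            no-increment e refl rewrite e = ≤-reflexive (+-identityʳ _)

          gap : ∀ {k l} → k ≤ l → l < d → b k + ascents l ≤ b l + ascents k
          gap = gap-nondecreasing ascents b (λ k → if isDescent k then 0 else 1) d (λ _ → refl) b-step

          ascents≤b : ∀ {l} → l < d → ascents l ≤ b l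
          ascents≤b l<d = ≤-trans (m≤n+m _ (b 0)) (≤-trans (gap z≤n l<d) (≤-reflexive (+-identityʳ _)))

          b≤ascents : ∀ {l} → l < d → b l ≤ ascents l
          b≤ascents {l} l<d = +-cancelʳ-≤ (ascents (d ∸ 1)) (b l) (ascents l) (begin
            b l + ascents (d ∸ 1)           ≤⟨ gap (<⇒≤∸1 l<d) (∸1< l<d) ⟩
            b (d ∸ 1) + ascents l           ≤⟨ +-monoˡ-≤ (ascents l) (≤-pred (<-≤-trans (b<χ (∸1< l<d)) χ≤colours)) ⟩
            ascents (d ∸ 1) + ascents l     ≡⟨ +-comm (ascents (d ∸ 1)) (ascents l) ⟩
            ascents l + ascents (d ∸ 1)     ∎)
            where open ≤-Reasoning

        ascents≡colour : ∀ i → ascents (toℕ i) ≡ toℕ (c (y i))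
        ascents≡colour i = trans (≤-antisym (ascents≤b (toℕ<n i)) (b≤ascents (toℕ<n i))) (zeroExtend-toℕ (toℕ ∘ c ∘ y) i)

        des≡d∸χ : des σ ≡ d ∸ ξ
        des≡d∸χ = ≤-antisym des≤d∸χ d∸χ≤des
          where
          d∸χ≤des : d ∸ ξ ≤ des σ
          d∸χ≤des with m≤n⇒m<n∨m≡n (z≤n {d})
          ... | inj₁ 0<d = subst (d ∸ ξ ≤_) (sym des≡d∸colours)
                             (∸-monoʳ-≤ d (≤-<-trans (ascents≤b (∸1< 0<d)) (b<χ (∸1< 0<d))))
          ... | inj₂ 0≡d = ≤-trans (m∸n≤m d ξ) (≤-trans (≤-reflexive (sym 0≡d)) z≤n)

  -- The coefficients β_j

  Pair : ℕ → Set
  Pair d = Orientation d × (Fin d → Fin d)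

  module Pairs {d} (adj : Graph d) (ω : Orientation d → Fin d → Fin d) where

    pairs : List (Pair d)
    pairs = concatMap (λ ρ → map (ρ ,_) (linearExtensions ρ)) (acyclicOrientations adj)

    labels : Pair d → Fin d → Fin d
    labels p i = ω (proj₁ p) (proj₂ p i)

    exponent : Pair d → ℤ
    exponent p = + (suc d C 2) - + comaj (labels p)

    withDescents : ℕ → List (Pair d)
    withDescents j = filterᵇ (λ p → des (labels p) ≡ᵇ j) pairs

    β≡ : ∀ j → β adj ω j ≡ map exponent (withDescents j)
    β≡ j = concatMap-if≡map-filterᵇ linearExtensions (λ ρ y → des (λ i → ω ρ (y i)) ≡ᵇ j)
             (λ ρ y → + (suc d C 2) - + comaj (λ i → ω ρ (y i))) (acyclicOrientations adj)

    exponent≡colourSum : ∀ p → exponent p ≡ + sum (map (suc ∘ Descents.ascents (entries (labels p))) (upTo d))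
    exponent≡colourSum p = begin
      + (suc d C 2) - + comaj σ      ≡⟨ cong (λ n → + n - + comaj σ) (colourSum+comaj σ) ⟨
      + (W + comaj σ) - + comaj σ    ≡⟨ +n-+m≡+[n∸m] (m≤n+m (comaj σ) W) ⟩
      + (W + comaj σ ∸ comaj σ)      ≡⟨ cong +_ (m+n∸n≡m W (comaj σ)) ⟩
      + W                            ∎
      where
      open ≡-Reasoning
      σ : Fin d → Fin d
      σ = labels p
      W : ℕ
      W = sum (map (suc ∘ Descents.ascents (entries σ)) (upTo d))

    ∈-pairs⁻ : ∀ {p} → p ∈ pairs → proj₁ p ∈ acyclicOrientations adj × proj₂ p ∈ linearExtensions (proj₁ p)
    ∈-pairs⁻ p∈ with ρ , ρ∈ , p∈′ ← find (∈-concatMap⁻ (λ ρ → map (ρ ,_) (linearExtensions ρ)) p∈)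
      with _ , y∈ , refl ← ∈-map⁻ (ρ ,_) p∈′ = ρ∈ , y∈

    ∈-pairs⁺ : ∀ {ρ y} → ρ ∈ acyclicOrientations adj → y ∈ linearExtensions ρ → (ρ , y) ∈ pairs
    ∈-pairs⁺ {ρ} ρ∈ y∈ = ∈-concatMap⁺ (λ ρ → map (ρ ,_) (linearExtensions ρ)) (lose ρ∈ (∈-map⁺ (ρ ,_) y∈))

    ∈-withDescents⁻ : ∀ {j p} → p ∈ withDescents j → p ∈ pairs × des (labels p) ≡ j
    ∈-withDescents⁻ {j} p∈ with p∈′ , e ← ∈-filterᵇ⁻ (λ p → des (labels p) ≡ᵇ j) {pairs} p∈ = p∈′ , ≡ᵇ-true⇒≡ e

    ∈-withDescents⁺ : ∀ {j p} → p ∈ pairs → des (labels p) ≡ j → p ∈ withDescents j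
    ∈-withDescents⁺ {j} p∈ e = ∈-filterᵇ⁺ (λ p → des (labels p) ≡ᵇ j) p∈ (≡⇒≡ᵇ-true e)

    withDescents-unique : ∀ j → Unique (withDescents j)
    withDescents-unique j = Uniqueₚ.filter⁺ (T? ∘ λ p → des (labels p) ≡ᵇ j) pairs-unique
      where
      pairs-unique : Unique pairs
      pairs-unique = go (acyclicOrientations-distinct adj)
        where
        go : ∀ {ρs} → Distinct _≗₂_ ρs → Unique (concatMap (λ ρ → map (ρ ,_) (linearExtensions ρ)) ρs)
        go [] = []
        go {ρ ∷ ρs} (ρ≉ρs ∷ dρs) =
          Uniqueₚ.++⁺ (Uniqueₚ.map⁺ (cong proj₂) (distinct⇒unique (λ _ → refl) (linearExtensions-distinct ρ))) (go dρs)
            (λ { (p∈ , p∈′) → apart p∈ p∈′ })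
          where
          apart : ∀ {p} → p ∈ map (ρ ,_) (linearExtensions ρ) → ¬ p ∈ concatMap (λ ρ → map (ρ ,_) (linearExtensions ρ)) ρs
          apart p∈ p∈′ with _ , _ , refl ← ∈-map⁻ (ρ ,_) p∈
                       with ρ′ , ρ′∈ , p∈″ ← find (∈-concatMap⁻ (λ ρ → map (ρ ,_) (linearExtensions ρ)) {xs = ρs} p∈′)
                       with _ , _ , refl ← ∈-map⁻ (ρ′ ,_) p∈″ = All.lookup ρ≉ρs ρ′∈ (λ u v → refl)

  module Coefficients {d} (adj : Graph d) (simple : IsSimple adj) (ω : Orientation d → Fin d → Fin d)
    (natural : ∀ ρ → isAcyclicOrientation adj ρ ≡ true → IsNaturalLabeling ρ (ω ρ)) where

    open Pairs adj ω public

    private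
      irreflexive : ∀ u → adj u u ≡ false
      irreflexive = proj₂ simple

      natural∈ : ∀ {ρ} → ρ ∈ acyclicOrientations adj → IsNaturalLabeling ρ (ω ρ)
      natural∈ ρ∈ = natural _ (∈-acyclicOrientations⁻ {adj = adj} ρ∈)

      orientation∈ : ∀ {ρ} → ρ ∈ acyclicOrientations adj → isOrientationOf adj ρ ≡ true
      orientation∈ ρ∈ = proj₁ (∧-true⁻ (∈-acyclicOrientations⁻ {adj = adj} ρ∈))

      module Greedy {p : Pair d} (p∈ : p ∈ pairs) =
        GreedyColouring {adj = adj} irreflexive (orientation∈ (proj₁ (∈-pairs⁻ p∈))) (natural∈ (proj₁ (∈-pairs⁻ p∈)))
                        (∈-linearExtensions⁻ (proj₂ (∈-pairs⁻ p∈)))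

    β-nonnegative : ∀ j → All (λ e → + 0 ℤ.≤ e) (β adj ω j)
    β-nonnegative j = subst (All (λ e → + 0 ℤ.≤ e)) (sym (β≡ j)) (All.tabulate nonnegative)
      where
      nonnegative : ∀ {e} → e ∈ map exponent (withDescents j) → + 0 ℤ.≤ e
      nonnegative e∈ with p , _ , refl ← ∈-map⁻ exponent e∈ = subst (+ 0 ℤ.≤_) (sym (exponent≡colourSum p)) (ℤ.+≤+ z≤n)

    private
      module ZeroDescents {ρ} (ρ∈ : ρ ∈ acyclicOrientations adj) where
        open NaturalLabeling (natural∈ ρ∈)

        ω⁻¹ : Fin d → Fin d
        ω⁻¹ i = proj₁ (surjective i)

        ω-ω⁻¹ : ∀ i → ω ρ (ω⁻¹ i) ≡ i
        ω-ω⁻¹ i = proj₂ (surjective i)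

        ω⁻¹-linearExtension : isLinearExtension ρ ω⁻¹ ≡ true
        ω⁻¹-linearExtension = isLinearExtension-intro
          (λ {i} {j} e → trans (sym (ω-ω⁻¹ i)) (trans (cong (ω ρ) e) (ω-ω⁻¹ j)))
          (λ v → ω ρ v , injective (ω-ω⁻¹ (ω ρ v)))
          (λ {i} {j} ≺ → subst₂ _<_ (cong toℕ (ω-ω⁻¹ i)) (cong toℕ (ω-ω⁻¹ j)) (monotone ≺))

        exists : ∃ λ p → p ∈ withDescents 0 × proj₁ p ≡ ρ
        exists with y , y∈ , ω⁻¹≗y ← linearExtensions-complete ρ ω⁻¹-linearExtension =
          (ρ , y) , ∈-withDescents⁺ (∈-pairs⁺ ρ∈ y∈) (increasing⇒des≡0 (λ i → ω ρ (y i)) increasing) , refl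
          where
          ω-y : ∀ i → ω ρ (y i) ≡ i
          ω-y i = trans (cong (ω ρ) (sym (ω⁻¹≗y i))) (ω-ω⁻¹ i)
          increasing : ∀ {i j} → toℕ i < toℕ j → toℕ (ω ρ (y i)) < toℕ (ω ρ (y j))
          increasing {i} {j} = subst₂ _<_ (cong toℕ (sym (ω-y i))) (cong toℕ (sym (ω-y j)))

        unique : ∀ {y} → (ρ , y) ∈ withDescents 0 → y ≗ ω⁻¹
        unique {y} p∈ i = injective (trans (ω∘y≗id i) (sym (ω-ω⁻¹ i)))
          where
          y-injective : ∀ {i j} → y i ≡ y j → i ≡ j
          y-injective = IsLinearExtension.injective {ρ = ρ} {y} (∈-linearExtensions⁻ (proj₂ (∈-pairs⁻ (proj₁ (∈-withDescents⁻ p∈)))))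
          ω∘y≗id : ∀ i → ω ρ (y i) ≡ i
          ω∘y≗id = strictlyIncreasing⇒idᶠ (λ i → ω ρ (y i))
            (des≡0⇒increasing (λ i → ω ρ (y i)) (λ e → y-injective (injective e)) (proj₂ (∈-withDescents⁻ p∈)))

    β₀↭ : β adj ω 0 ↭ replicate (length (acyclicOrientations adj)) (+ (suc d C 2))
    β₀↭ = subst₂ _↭_ (sym (β≡ 0)) (map-const (+ (suc d C 2)) (acyclicOrientations adj)) (↭-sym
      (↭-correspondence (λ ρ p → proj₁ p ≡ ρ) (λ _ → + (suc d C 2)) exponent
        (distinct⇒unique (λ _ _ → refl) (acyclicOrientations-distinct adj)) (withDescents-unique 0)
        ZeroDescents.exists
        (λ p∈ → _ , proj₁ (∈-pairs⁻ (proj₁ (∈-withDescents⁻ p∈))) , refl)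
        functional
        (λ _ _ _ e e′ → trans (sym e) e′)
        weight))
      where
      functional : ∀ {ρ p p′} → ρ ∈ acyclicOrientations adj → p ∈ withDescents 0 → p′ ∈ withDescents 0 →
                   proj₁ p ≡ ρ → proj₁ p′ ≡ ρ → p ≡ p′
      functional {p = ρ , y} {ρ , y′} ρ∈ p∈ p′∈ refl refl =
        cong (ρ ,_) (distinct⇒≡ (λ e i → sym (e i)) (linearExtensions-distinct ρ)
          (proj₂ (∈-pairs⁻ (proj₁ (∈-withDescents⁻ p∈)))) (proj₂ (∈-pairs⁻ (proj₁ (∈-withDescents⁻ p′∈))))
          (λ i → trans (ZeroDescents.unique ρ∈ p∈ i) (sym (ZeroDescents.unique ρ∈ p′∈ i))))
      weight : ∀ {ρ p} → ρ ∈ acyclicOrientations adj → p ∈ withDescents 0 → proj₁ p ≡ ρ → + (suc d C 2) ≡ exponent p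
      weight {p = p} _ p∈ _ = sym (trans (cong (λ m → + (suc d C 2) - + m) (des≡0⇒comaj≡0 (labels p) (proj₂ (∈-withDescents⁻ p∈))))
                                         (+n-+m≡+[n∸m] z≤n))

    module LeadingCoefficient {ξ} (χ : IsChromaticNumber adj ξ) where

      private
        minimal : ∀ m (c : Fin d → Fin m) → isProperColoring adj c ≡ true → ξ ≤ m
        minimal = proj₂ χ

        des≤d∸χ : ∀ {p} → p ∈ pairs → des (labels p) ≤ d ∸ ξ
        des≤d∸χ p∈ = Greedy.ChromaticBound.des≤d∸χ p∈ minimal

      β-vanishes : ∀ j → d ∸ ξ < j → β adj ω j ≡ []
      β-vanishes j d∸χ<j = trans (β≡ j) (cong (map exponent)
        (filterᵇ-none (λ p → des (labels p) ≡ᵇ j) λ p∈ → ≢⇒≡ᵇ-false (<⇒≢ (≤-<-trans (des≤d∸χ p∈) d∸χ<j))))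

      IsGreedyColouring : (Fin d → Fin ξ) → Pair d → Set
      IsGreedyColouring c p = ∀ i → Descents.ascents (entries (labels p)) (toℕ i) ≡ toℕ (c (proj₂ p i))

      private
        colourings : List (Fin d → Fin ξ)
        colourings = properColorings adj ξ
        top : List (Pair d)
        top = withDescents (d ∸ ξ)

        module FromPair {p} (p∈ : p ∈ top) where
          private
            module G = Greedy (proj₁ (∈-withDescents⁻ p∈))
            open G.ChromaticBound minimal using (colour<χ)
            on-top : des (labels p) ≡ d ∸ ξ
            on-top = proj₂ (∈-withDescents⁻ p∈)

          greedy-χ : Fin d → Fin ξ
          greedy-χ v = fromℕ< (colour<χ on-top v)

          toℕ-greedy-χ : ∀ v → toℕ (greedy-χ v) ≡ G.colour v
          toℕ-greedy-χ v = toℕ-fromℕ< (colour<χ on-top v)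

          greedy-χ-proper : isProperColoring adj greedy-χ ≡ true
          greedy-χ-proper = isProperColoring⁺ {adj = adj} {c = greedy-χ} λ {u} {v} edge same →
            G.colour-proper edge (trans (sym (toℕ-greedy-χ u)) (trans (cong toℕ same) (toℕ-greedy-χ v)))

          greedy-χ-isGreedy : IsGreedyColouring greedy-χ p
          greedy-χ-isGreedy i = trans (sym (G.colour-y i)) (sym (toℕ-greedy-χ (proj₂ p i)))

        colouring-of-pair : ∀ {p} → p ∈ top → ∃ λ c → c ∈ colourings × IsGreedyColouring c p
        colouring-of-pair {p} p∈ =
          let c , c∈ , c≗ = properColorings-complete adj {c = FromPair.greedy-χ p∈} (FromPair.greedy-χ-proper p∈)
          in c , c∈ , λ i → trans (FromPair.greedy-χ-isGreedy p∈ i) (cong toℕ (c≗ (proj₂ p i)))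

        sorted-pair : ∀ {c ρ y} → (ρ , y) ∈ pairs → (∀ {i j} → toℕ i < toℕ j → ColourOrder (toℕ ∘ c) (ω ρ) (y i) (y j)) →
                      (ρ , y) ∈ top × IsGreedyColouring c (ρ , y)
        sorted-pair {c} p∈ y-sorted = ∈-withDescents⁺ p∈ S.des≡d∸χ , S.ascents≡colour
          where module S = Greedy.ChromaticBound.SortedBy p∈ minimal c y-sorted

        arcs-increase : ∀ {c ρ} → c ∈ colourings → colourOrientation adj c ≗₂ ρ → ∀ {u v} → ρ u v ≡ true → toℕ (c u) < toℕ (c v)
        arcs-increase c∈ c≗ρ {u} {v} arc =
          colourOrientation-increasing simple (∈-properColorings⁻ {adj = adj} c∈) (trans (c≗ρ u v) arc)

        pair-of-colouring : ∀ {c} → c ∈ colourings → ∃ λ p → p ∈ top × IsGreedyColouring c p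
        pair-of-colouring {c} c∈ =
          let ρ , ρ∈ , c≗ρ = acyclicOrientations-complete adj (colourOrientation-acyclic simple (∈-properColorings⁻ {adj = adj} c∈))
              y , y∈ , sorted≗y = linearExtensions-complete ρ
                (colourSorted-linearExtension (toℕ ∘ c) (arcs-increase c∈ c≗ρ) (ω ρ) (NaturalLabeling.injective (natural∈ ρ∈)))
          in (ρ , y) , sorted-pair {c} (∈-pairs⁺ ρ∈ y∈) λ i<j →
              subst₂ (ColourOrder (toℕ ∘ c) (ω ρ)) (sorted≗y _) (sorted≗y _)
                     (ColourSorted.sorted-increasing (toℕ ∘ c) (ω ρ) (NaturalLabeling.injective (natural∈ ρ∈)) i<j)

        module FromGreedy (c : Fin d → Fin ξ) {p} (p∈ : p ∈ top) (greedy : IsGreedyColouring c p) where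
          private
            module G = Greedy (proj₁ (∈-withDescents⁻ p∈))

          colour≗ : ∀ v → G.colour v ≡ toℕ (c v)
          colour≗ v = trans (greedy (G.position v)) (cong (toℕ ∘ c) (G.y-position v))

          orientation≗ : proj₁ p ≗₂ colourOrientation adj c
          orientation≗ u v = trans (G.ρ≡byColour u v) (cong₂ (λ a b → adj u v ∧ (a <ᵇ b)) (colour≗ u) (colour≗ v))

          listing-sorted : ∀ {i j} → toℕ i < toℕ j → ColourOrder (toℕ ∘ c) (ω (proj₁ p)) (proj₂ p i) (proj₂ p j)
          listing-sorted i<j = colourOrder-cong G.colour (ω (proj₁ p)) colour≗ (G.sorted-by-colour i<j)

          listing-injective : ∀ {i j} → proj₂ p i ≡ proj₂ p j → i ≡ j
          listing-injective = IsLinearExtension.injective {ρ = proj₁ p} {proj₂ p} (∈-linearExtensions⁻ (proj₂ (∈-pairs⁻ (proj₁ (∈-withDescents⁻ p∈)))))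

          listing-surjective : ∀ v → ∃ λ i → proj₂ p i ≡ v
          listing-surjective = IsLinearExtension.surjective {ρ = proj₁ p} {proj₂ p} (∈-linearExtensions⁻ (proj₂ (∈-pairs⁻ (proj₁ (∈-withDescents⁻ p∈)))))

        orientation-determined : ∀ {c ρ y ρ′ y′} → (ρ , y) ∈ top → (ρ′ , y′) ∈ top →
          IsGreedyColouring c (ρ , y) → IsGreedyColouring c (ρ′ , y′) → ρ ≡ ρ′
        orientation-determined {c} p∈ p′∈ g g′ =
          distinct⇒≡ ≗₂-sym (acyclicOrientations-distinct adj)
            (proj₁ (∈-pairs⁻ (proj₁ (∈-withDescents⁻ p∈)))) (proj₁ (∈-pairs⁻ (proj₁ (∈-withDescents⁻ p′∈))))
            (λ u v → trans (FromGreedy.orientation≗ c p∈ g u v) (sym (FromGreedy.orientation≗ c p′∈ g′ u v)))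

        functional : ∀ {c p p′} → c ∈ colourings → p ∈ top → p′ ∈ top → IsGreedyColouring c p → IsGreedyColouring c p′ → p ≡ p′
        functional {c} {ρ , y} {ρ′ , y′} _ p∈ p′∈ g g′ = cong₂ _,_ ρ≡ρ′ (distinct⇒≡ (λ e i → sym (e i)) (linearExtensions-distinct ρ′)
            (subst (λ r → y ∈ linearExtensions r) ρ≡ρ′ (proj₂ (∈-pairs⁻ (proj₁ (∈-withDescents⁻ p∈)))))
            (proj₂ (∈-pairs⁻ (proj₁ (∈-withDescents⁻ p′∈))))
            (λ i → trans (sorted-unique y y-sorted i) (sym (sorted-unique y′ (FromGreedy.listing-sorted c p′∈ g′) i))))
          where
          ρ≡ρ′ : ρ ≡ ρ′
          ρ≡ρ′ = orientation-determined {c} p∈ p′∈ g g′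
          open ColourSorted (toℕ ∘ c) (ω ρ′) (NaturalLabeling.injective (natural∈ (proj₁ (∈-pairs⁻ (proj₁ (∈-withDescents⁻ p′∈))))))
          y-sorted : ∀ {i j} → toℕ i < toℕ j → ColourOrder (toℕ ∘ c) (ω ρ′) (y i) (y j)
          y-sorted = subst (λ r → ∀ {i j} → toℕ i < toℕ j → ColourOrder (toℕ ∘ c) (ω r) (y i) (y j)) ρ≡ρ′
                           (FromGreedy.listing-sorted c p∈ g)

        injective : ∀ {c c′ p} → c ∈ colourings → c′ ∈ colourings → p ∈ top → IsGreedyColouring c p → IsGreedyColouring c′ p → c ≡ c′
        injective {c} {c′} {p} c∈ c′∈ p∈ g g′ = distinct⇒≡ (λ e i → sym (e i)) (properColorings-distinct adj ξ) c∈ c′∈ λ v →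
          let i , yi≡v = FromGreedy.listing-surjective c p∈ g v
          in subst (λ w → c w ≡ c′ w) yi≡v (toℕ-injective (trans (sym (g i)) (g′ i)))

        weight : ∀ {c p} → c ∈ colourings → p ∈ top → IsGreedyColouring c p → + colorSum c ≡ exponent p
        weight {c} {p} _ p∈ g = sym (begin
          exponent p                                                  ≡⟨ exponent≡colourSum p ⟩
          + sum (map (suc ∘ ascents) (upTo d))                        ≡⟨ cong +_ (sum-allFin≡sum-upTo d (suc ∘ ascents)) ⟨
          + sum (map (suc ∘ ascents ∘ toℕ) (allFin d))                ≡⟨ cong (+_ ∘ sum) (map-cong (cong suc ∘ g) (allFin d)) ⟩
          + sum (map (λ i → suc (toℕ (c (proj₂ p i)))) (allFin d))    ≡⟨ cong +_ (sum-permute (proj₂ p) (FromGreedy.listing-injective c p∈ g)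
                                                                                      (FromGreedy.listing-surjective c p∈ g) (suc ∘ toℕ ∘ c)) ⟩
          + colorSum c                                                ∎)
          where
          open ≡-Reasoning
          open Descents (entries (labels p))

      β-top↭ : β adj ω (d ∸ ξ) ↭ map (λ c → + colorSum c) (properColorings adj ξ)
      β-top↭ = subst (_↭ map (λ c → + colorSum c) colourings) (sym (β≡ (d ∸ ξ))) (↭-sym
        (↭-correspondence IsGreedyColouring (λ c → + colorSum c) exponent
          (distinct⇒unique (λ _ → refl) (properColorings-distinct adj ξ)) (withDescents-unique (d ∸ ξ))
          pair-of-colouring colouring-of-pair functional injective weight))

      β-top≢[] : β adj ω (d ∸ ξ) ≢ []
      β-top≢[] β≡[] =
        let c , c∈ , _ = properColorings-complete adj (proj₂ (proj₁ χ))
            p , p∈ , _ = pair-of-colouring c∈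
        in case subst (exponent p ∈_) (trans (sym (β≡ (d ∸ ξ))) β≡[]) (∈-map⁺ exponent p∈) of λ ()

  -- Trees

  module RootedTree {n} (adj : Graph (suc n)) (simple : IsSimple adj) (connected : Connected adj) where

    root : Fin (suc n)
    root = Fin.zero

    private
      reach : ∀ v → ∃ λ k → walk adj k root v ≡ true
      reach v with k , f , f0 , fk , edges ← connected root v =
        k , subst₂ (λ a b → walk adj k a b ≡ true) f0 fk (path⇒walk adj k f edges)

    -- depth and parent are searches; kept opaque, since unfolding them makes normalisation explode
    opaque
      depth : Fin (suc n) → ℕ
      depth v = least (λ k → walk adj k root v) (proj₁ (reach v))

      depth-walk : ∀ v → walk adj (depth v) root v ≡ true
      depth-walk v = least-satisfies (λ k → walk adj k root v) (proj₁ (reach v)) (proj₂ (reach v)) ≤-refl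

      depth-minimal : ∀ {m v} → walk adj m root v ≡ true → depth v ≤ m
      depth-minimal {v = v} = least≤witness (λ k → walk adj k root v) (proj₁ (reach v))

    depth≡0⇒root : ∀ {v} → depth v ≡ 0 → v ≡ root
    depth≡0⇒root {v} depth≡0 = sym (=ᶠ⇒≡ (subst (λ k → walk adj k root v ≡ true) depth≡0 (depth-walk v)))

    depth-suc : ∀ {v} → v ≢ root → ∃ λ k → depth v ≡ suc k
    depth-suc {v} v≢root with depth v in depth-v
    ... | zero = ⊥-elim (v≢root (depth≡0⇒root depth-v))
    ... | suc k = k , refl

    opaque
      parent : Fin (suc n) → Fin (suc n)
      parent v with any? (λ x → (walk adj (depth v ∸ 1) root x ∧ adj x v) Bool.≟ true)
      ... | yes (x , _) = x
      ... | no _ = root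

      private
        parent-spec : ∀ {v} → v ≢ root → walk adj (depth v ∸ 1) root (parent v) ≡ true × adj (parent v) v ≡ true
        parent-spec {v} v≢root with any? (λ x → (walk adj (depth v ∸ 1) root x ∧ adj x v) Bool.≟ true)
        ... | yes (x , found) = ∧-true⁻ found
        ... | no none =
          let k , depth-v = depth-suc v≢root
              x , w , edge = walk-snoc⁻ adj k (subst (λ m → walk adj m root v ≡ true) depth-v (depth-walk v))
          in ⊥-elim (none (x , ∧-true⁺ (subst (λ m → walk adj (m ∸ 1) root x ≡ true) (sym depth-v) w) edge))

    parent-edge : ∀ {v} → v ≢ root → adj v (parent v) ≡ true
    parent-edge {v} v≢root = trans (proj₁ simple v (parent v)) (proj₂ (parent-spec v≢root))

    depth-parent : ∀ {v} → v ≢ root → depth v ≡ suc (depth (parent v))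
    depth-parent {v} v≢root = ≤-antisym
      (depth-minimal (walk-snoc⁺ adj (depth (parent v)) (depth-walk (parent v)) (proj₂ (parent-spec v≢root))))
      (subst (suc (depth (parent v)) ≤_) (sym depth-v)
        (s≤s (depth-minimal (subst (λ m → walk adj (m ∸ 1) root (parent v) ≡ true) depth-v (proj₁ (parent-spec v≢root))))))
      where
      depth-v : depth v ≡ suc (proj₁ (depth-suc v≢root))
      depth-v = proj₂ (depth-suc v≢root)

    depth>0⇒≢root : ∀ {v} → 0 < depth v → v ≢ root
    depth>0⇒≢root 0<depth refl = <-irrefl (sym (n≤0⇒n≡0 (depth-minimal (≡⇒=ᶠ {i = root} refl)))) 0<depth

    ancestor : Fin (suc n) → ℕ → Fin (suc n)
    ancestor v zero = v
    ancestor v (suc t) = parent (ancestor v t)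

    depth-ancestor : ∀ v {t} → t ≤ depth v → depth (ancestor v t) ≡ depth v ∸ t
    ancestor-≢root : ∀ v {t} → t < depth v → ancestor v t ≢ root

    depth-ancestor v {zero} _ = refl
    depth-ancestor v {suc t} t<depth = suc-injective (begin
      suc (depth (parent (ancestor v t)))  ≡⟨ depth-parent (ancestor-≢root v t<depth) ⟨
      depth (ancestor v t)                 ≡⟨ depth-ancestor v (<⇒≤ t<depth) ⟩
      depth v ∸ t                          ≡⟨ ∸≡suc∸suc t<depth ⟩
      suc (depth v ∸ suc t)                ∎)
      where open ≡-Reasoning

    ancestor-≢root v {t} t<depth =
      depth>0⇒≢root (subst (0 <_) (sym (trans (depth-ancestor v (<⇒≤ t<depth)) (∸≡suc∸suc t<depth))) (s≤s z≤n))

    ancestor-edge : ∀ v {t} → t < depth v → adj (ancestor v t) (ancestor v (suc t)) ≡ true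
    ancestor-edge v t<depth = parent-edge (ancestor-≢root v t<depth)

    ancestor-injective : ∀ v {t t′} → t ≤ depth v → t′ ≤ depth v → ancestor v t ≡ ancestor v t′ → t ≡ t′
    ancestor-injective v t≤ t′≤ same =
      ∸-cancelˡ-≡ t≤ t′≤ (trans (sym (depth-ancestor v t≤)) (trans (cong depth same) (depth-ancestor v t′≤)))

    ancestor-root : ∀ v → ancestor v (depth v) ≡ root
    ancestor-root v = depth≡0⇒root (trans (depth-ancestor v ≤-refl) (n∸n≡0 (depth v)))

    IsParentEdge : Fin (suc n) → Fin (suc n) → Set
    IsParentEdge u v = u ≢ root × parent u ≡ v

    parentEdge-asym : ∀ {u v} → IsParentEdge u v → ¬ IsParentEdge v u
    parentEdge-asym (u≢root , pu≡v) (v≢root , pv≡u) =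
      <-irrefl (trans (trans (depth-parent u≢root) (cong (suc ∘ depth) pu≡v))
                      (cong suc (trans (depth-parent v≢root) (cong (suc ∘ depth) pv≡u))))
               (≤-trans (n<1+n _) (n≤1+n _))

    parentEdge⇒edge : ∀ {u v} → IsParentEdge u v → adj u v ≡ true
    parentEdge⇒edge (u≢root , refl) = parent-edge u≢root

    parentEdge? : ∀ u v → Dec (IsParentEdge u v)
    parentEdge? u v = ¬? (u ≟ root) ×-dec (parent u ≟ v)

    -- an edge uv that is not a parent edge closes a cycle: from u up its ancestor line to the first
    -- vertex also on the ancestor line of v, then down that line to v
    private
      module CycleThroughEdge {u v} (edge : adj u v ≡ true) (¬uv : ¬ IsParentEdge u v) (¬vu : ¬ IsParentEdge v u) where

        onLineOfU : ℕ → Bool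
        onLineOfU s = any (λ t → ancestor u t =ᶠ ancestor v s) (upTo (suc (depth u)))

        opaque
          j : ℕ
          j = least onLineOfU (depth v)

          j≤ : j ≤ depth v
          j≤ = least≤ onLineOfU (depth v)

          junction : ∃ λ i → i ∈ upTo (suc (depth u)) × (ancestor u i =ᶠ ancestor v j) ≡ true
          junction = any-true⁻ _ (least-satisfies onLineOfU (depth v)
            (any-true⁺ (λ t → ancestor u t =ᶠ ancestor v (depth v)) (∈-upTo⁺ (n<1+n (depth u)))
                       (≡⇒=ᶠ (trans (ancestor-root u) (sym (ancestor-root v))))) ≤-refl)

          before-j : ∀ {s t} → s < j → t ≤ depth u → ancestor u t ≢ ancestor v s
          before-j {s} {t} s<j t≤ = =ᶠ-false⇒≢ (any-false⁻ (λ t → ancestor u t =ᶠ ancestor v s)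
                                                 (least-minimal onLineOfU (depth v) s<j) (∈-upTo⁺ (s≤s t≤)))

        i : ℕ
        i = proj₁ junction

        i≤ : i ≤ depth u
        i≤ = ≤-pred (∈-upTo⁻ (proj₁ (proj₂ junction)))

        meet : ancestor u i ≡ ancestor v j
        meet = =ᶠ⇒≡ (proj₂ (proj₂ junction))

        L : ℕ
        L = i + j

        vertex : ℕ → Fin (suc n)
        vertex a = if a ≤ᵇ i then ancestor u a else ancestor v (L ∸ a)

        vertex-up : ∀ {a} → a ≤ i → vertex a ≡ ancestor u a
        vertex-up {a} a≤i rewrite T⇒≡true (≤⇒≤ᵇ a≤i) = refl

        vertex-down : ∀ {a} → i ≤ a → vertex a ≡ ancestor v (L ∸ a)
        vertex-down {a} i≤a with a ≤ᵇ i in a≤ᵇi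
        ... | false = refl
        ... | true with refl ← ≤-antisym (≤ᵇ⇒≤ a i (≡true⇒T a≤ᵇi)) i≤a =
          trans meet (cong (ancestor v) (sym (m+n∸m≡n a j)))

        L∸≤j : ∀ {a} → i ≤ a → L ∸ a ≤ j
        L∸≤j i≤a = ≤-trans (∸-monoʳ-≤ L i≤a) (≤-reflexive (m+n∸m≡n i j))

        2≤L : 2 ≤ L
        2≤L = long i j refl refl meet i≤ j≤
          where
          long : ∀ a b → a ≡ i → b ≡ j → ancestor u a ≡ ancestor v b → a ≤ depth u → b ≤ depth v → 2 ≤ a + b
          long zero zero _ _ refl _ _ with () ← trans (sym (proj₂ simple u)) edge
          long zero (suc zero) _ _ u≡pv _ 1≤ = ⊥-elim (¬vu (ancestor-≢root v 1≤ , sym u≡pv))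
          long (suc zero) zero _ _ pu≡v 1≤ _ = ⊥-elim (¬uv (ancestor-≢root u 1≤ , pu≡v))
          long zero (suc (suc b)) _ _ _ _ _ = s≤s (s≤s z≤n)
          long (suc zero) (suc b) _ _ _ _ _ = s≤s (s≤s z≤n)
          long (suc (suc a)) b _ _ _ _ _ = s≤s (s≤s z≤n)

        vertex-edge : ∀ {a} → a < L → adj (vertex a) (vertex (suc a)) ≡ true
        vertex-edge {a} a<L with suc a ≤? i
        ... | yes 1+a≤i = subst₂ (λ x y → adj x y ≡ true) (sym (vertex-up (<⇒≤ 1+a≤i))) (sym (vertex-up 1+a≤i))
                                  (ancestor-edge u (≤-trans 1+a≤i i≤))
        ... | no 1+a≰i = subst₂ (λ x y → adj x y ≡ true)
                                (sym (trans (vertex-down i≤a) (cong (ancestor v) (∸≡suc∸suc a<L))))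
                                (sym (vertex-down (≤-trans i≤a (n≤1+n a))))
                                (trans (proj₁ simple _ _) (ancestor-edge v (<-≤-trans (subst (L ∸ suc a <_) (sym (∸≡suc∸suc a<L)) (n<1+n _))
                                                                                       (≤-trans (L∸≤j i≤a) j≤))))
          where
          i≤a : i ≤ a
          i≤a = ≤-pred (≰⇒> 1+a≰i)

        vertex-injective : ∀ {a b} → a ≤ L → b ≤ L → vertex a ≡ vertex b → a ≡ b
        vertex-injective {a} {b} a≤L b≤L same with a ≤? i | b ≤? i
        ... | yes a≤i | yes b≤i =
          ancestor-injective u (≤-trans a≤i i≤) (≤-trans b≤i i≤) (trans (sym (vertex-up a≤i)) (trans same (vertex-up b≤i)))
        ... | no a≰i | no b≰i = ∸-cancelˡ-≡ a≤L b≤L (ancestor-injective v (≤-trans (L∸≤j i≤a) j≤) (≤-trans (L∸≤j i≤b) j≤)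
            (trans (sym (vertex-down i≤a)) (trans same (vertex-down i≤b))))
          where
          i≤a : i ≤ a
          i≤a = <⇒≤ (≰⇒> a≰i)
          i≤b : i ≤ b
          i≤b = <⇒≤ (≰⇒> b≰i)
        ... | yes a≤i | no b≰i = ⊥-elim (before-j (below b≤L b≰i) (≤-trans a≤i i≤)
            (trans (sym (vertex-up a≤i)) (trans same (vertex-down (<⇒≤ (≰⇒> b≰i))))))
          where
          below : ∀ {c} → c ≤ L → ¬ c ≤ i → L ∸ c < j
          below c≤L c≰i = <-≤-trans (∸-monoʳ-< (≰⇒> c≰i) c≤L) (≤-reflexive (m+n∸m≡n i j))
        ... | no a≰i | yes b≤i = ⊥-elim (before-j (below a≤L a≰i) (≤-trans b≤i i≤)
            (trans (sym (vertex-up b≤i)) (trans (sym same) (vertex-down (<⇒≤ (≰⇒> a≰i))))))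
          where
          below : ∀ {c} → c ≤ L → ¬ c ≤ i → L ∸ c < j
          below c≤L c≰i = <-≤-trans (∸-monoʳ-< (≰⇒> c≰i) c≤L) (≤-reflexive (m+n∸m≡n i j))

        cycle : HasCycle adj
        cycle = L ∸ 2 , vertex ∘ toℕ , injective , edges , closing
          where
          L≡ : suc (suc (L ∸ 2)) ≡ L
          L≡ = m+[n∸m]≡n 2≤L
          bounded : ∀ (x : Fin (suc (suc (suc (L ∸ 2))))) → toℕ x ≤ L
          bounded x = subst (toℕ x ≤_) L≡ (≤-pred (toℕ<n x))
          injective : ∀ x y → vertex (toℕ x) ≡ vertex (toℕ y) → x ≡ y
          injective x y same = toℕ-injective (vertex-injective (bounded x) (bounded y) same)
          edges : ∀ (x : Fin (suc (suc (L ∸ 2)))) → adj (vertex (toℕ (inject₁ x))) (vertex (toℕ (Fin.suc x))) ≡ true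
          edges x rewrite toℕ-inject₁ x = vertex-edge (subst (toℕ x <_) L≡ (toℕ<n x))
          closing : adj (vertex (toℕ (fromℕ (suc (suc (L ∸ 2)))))) (vertex 0) ≡ true
          closing = subst (λ a → adj (vertex a) (vertex 0) ≡ true) (sym (trans (toℕ-fromℕ _) L≡))
            (subst₂ (λ x y → adj x y ≡ true) (sym (trans (vertex-down (m≤m+n i j)) (cong (ancestor v) (n∸n≡0 L))))
                    (sym (vertex-up z≤n)) (trans (proj₁ simple v u) edge))

    module _ (acyclic : ¬ HasCycle adj) where

      edge⇒parentEdge : ∀ {u v} → adj u v ≡ true → IsParentEdge u v ⊎ IsParentEdge v u
      edge⇒parentEdge {u} {v} edge with parentEdge? u v | parentEdge? v u
      ... | yes uv | _ = inj₁ uv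
      ... | no _ | yes vu = inj₂ vu
      ... | no ¬uv | no ¬vu = ⊥-elim (acyclic (CycleThroughEdge.cycle edge ¬uv ¬vu))

    isChildOfᵇ : Fin (suc n) → Fin (suc n) → Bool
    isChildOfᵇ x y = not (x =ᶠ root) ∧ (parent x =ᶠ y)

    isChildOfᵇ-true : ∀ {x y} → IsParentEdge x y → isChildOfᵇ x y ≡ true
    isChildOfᵇ-true (x≢root , refl) rewrite ≢⇒=ᶠ-false x≢root = ≡⇒=ᶠ refl

    isChildOfᵇ-false : ∀ {x y} → ¬ IsParentEdge x y → isChildOfᵇ x y ≡ false
    isChildOfᵇ-false {x} {y} ¬xy with x =ᶠ root in x=root | parent x =ᶠ y in px=y
    ... | true | _ = refl
    ... | false | false = refl
    ... | false | true = ⊥-elim (¬xy (=ᶠ-false⇒≢ x=root , =ᶠ⇒≡ px=y))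

    isChildOfᵇ-true⁻ : ∀ {x y} → isChildOfᵇ x y ≡ true → IsParentEdge x y
    isChildOfᵇ-true⁻ {x} {y} e with x≠root , px=y ← ∧-true⁻ {not (x =ᶠ root)} e = =ᶠ-false⇒≢ (not-true⁻ x≠root) , =ᶠ⇒≡ px=y

    -- up x says whether the edge between x and its parent points upwards
    orient : (Fin (suc n) → Bool) → Orientation (suc n)
    orient up x y = (isChildOfᵇ x y ∧ up x) ∨ (isChildOfᵇ y x ∧ not (up y))

    module _ (up : Fin (suc n) → Bool) where

      orient-upward : ∀ {x y} → IsParentEdge x y → orient up x y ≡ up x
      orient-upward xy rewrite isChildOfᵇ-true xy | isChildOfᵇ-false (parentEdge-asym xy) = ∨-identityʳ _

      orient-downward : ∀ {x y} → IsParentEdge y x → orient up x y ≡ not (up y)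
      orient-downward yx rewrite isChildOfᵇ-false (parentEdge-asym yx) | isChildOfᵇ-true yx = refl

      orient-off : ∀ {x y} → ¬ IsParentEdge x y → ¬ IsParentEdge y x → orient up x y ≡ false
      orient-off ¬xy ¬yx rewrite isChildOfᵇ-false ¬xy | isChildOfᵇ-false ¬yx = refl

      orient-arc⁻ : ∀ {x y} → orient up x y ≡ true → (IsParentEdge x y × up x ≡ true) ⊎ (IsParentEdge y x × up y ≡ false)
      orient-arc⁻ {x} {y} arc with isChildOfᵇ x y in xy | isChildOfᵇ y x in yx | up x in ux | up y in uy
      ... | true | _ | true | _ = inj₁ (isChildOfᵇ-true⁻ xy , refl)
      ... | _ | true | _ | false = inj₂ (isChildOfᵇ-true⁻ yx , refl)
      ... | false | false | _ | _ = case arc of λ ()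
      ... | false | true | _ | true = case arc of λ ()
      ... | true | false | false | _ = case arc of λ ()
      ... | true | true | false | true = case arc of λ ()

    module _ (acyclic : ¬ HasCycle adj) (up : Fin (suc n) → Bool) where

      orient-isOrientation : isOrientationOf adj (orient up) ≡ true
      orient-isOrientation = isOrientationOf-intro {adj = adj} {ρ = orient up} on-edges off-edges
        where
        on-edges : ∀ x y → adj x y ≡ true → (orient up x y xor orient up y x) ≡ true
        on-edges x y edge with edge⇒parentEdge acyclic edge
        ... | inj₁ xy rewrite orient-upward up xy | orient-downward up xy = xor-inverseʳ (up x)
        ... | inj₂ yx rewrite orient-downward up yx | orient-upward up yx = xor-inverseˡ (up y)
        off-edges : ∀ x y → adj x y ≡ false → orient up x y ≡ false
        off-edges x y ¬edge = orient-off up (λ xy → case trans (sym ¬edge) (parentEdge⇒edge xy) of λ ())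
                                            (λ yx → case trans (sym ¬edge) (trans (proj₁ simple x y) (parentEdge⇒edge yx)) of λ ())

      -- on a closed walk, the deepest vertex would need its parent edge to point both up and down
      no-closed-sequence : ∀ k (f : ℕ → Fin (suc n)) → f (suc k) ≡ f 0 → (∀ i → i < suc k → orient up (f i) (f (suc i)) ≡ true) → ⊥
      no-closed-sequence k f closed arcs =
        let m , m≤k , maximal = argmax (depth ∘ f) k
        in no-way-in m (predecessor m m≤k (on-closed-walk m maximal)) (points-up m m≤k (on-closed-walk m maximal))
        where
        on-closed-walk : ∀ m → (∀ t → t ≤ k → depth (f t) ≤ depth (f m)) → ∀ t → t ≤ suc k → depth (f t) ≤ depth (f m)
        on-closed-walk m maximal t t≤1+k with m≤n⇒m<n∨m≡n t≤1+k
        ... | inj₁ (s≤s t≤k) = maximal t t≤k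
        ... | inj₂ refl = subst (λ z → depth z ≤ depth (f m)) (sym closed) (maximal 0 z≤n)

        points-up : ∀ m → m ≤ k → (∀ t → t ≤ suc k → depth (f t) ≤ depth (f m)) → up (f m) ≡ true
        points-up m m≤k deepest with orient-arc⁻ up (arcs m (s≤s m≤k))
        ... | inj₁ (_ , upward) = upward
        ... | inj₂ ((child≢root , parent≡) , _) = ⊥-elim (<-irrefl refl (≤-trans
              (≤-reflexive (sym (trans (depth-parent child≢root) (cong (suc ∘ depth) parent≡)))) (deepest (suc m) (s≤s m≤k))))

        predecessor : ∀ m → m ≤ k → (∀ t → t ≤ suc k → depth (f t) ≤ depth (f m)) →
                      ∃ λ a → orient up a (f m) ≡ true × depth a ≤ depth (f m)
        predecessor zero _ deepest = f k , subst (λ z → orient up (f k) z ≡ true) closed (arcs k ≤-refl) , deepest k (n≤1+n k)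
        predecessor (suc m) m<k deepest =
          f m , arcs m (s≤s (<⇒≤ m<k)) , deepest m (≤-trans (n≤1+n m) (≤-trans m<k (n≤1+n k)))

        no-way-in : ∀ m → (∃ λ a → orient up a (f m) ≡ true × depth a ≤ depth (f m)) → up (f m) ≡ true → ⊥
        no-way-in m (a , arc , shallower) upward with orient-arc⁻ up arc
        ... | inj₁ ((a≢root , parent≡) , _) =
          <-irrefl refl (≤-trans (≤-reflexive (sym (trans (depth-parent a≢root) (cong (suc ∘ depth) parent≡)))) shallower)
        ... | inj₂ (_ , downward) = case trans (sym downward) upward of λ ()

      orient-acyclic : isAcyclicOrientation adj (orient up) ≡ true
      orient-acyclic = isAcyclicOrientation-intro {adj = adj} orient-isOrientation no-closed-walk
        where
        no-closed-walk : ∀ k u → walk (orient up) (suc k) u u ≡ false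
        no-closed-walk k u with walk (orient up) (suc k) u u in closed
        ... | false = refl
        ... | true = let f , f0 , fk , arcs = walk⇒sequence (orient up) (suc k) closed
                     in ⊥-elim (no-closed-sequence k f (trans fk (sym f0)) arcs)

    module _ (acyclic : ¬ HasCycle adj) where

      orient-recover : ∀ {ρ} → isOrientationOf adj ρ ≡ true → (up : Fin (suc n) → Bool) →
                       (∀ x → x ≢ root → up x ≡ ρ x (parent x)) → orient up ≗₂ ρ
      orient-recover {ρ} o up up≗ x y with adj x y in edge
      ... | true with edge⇒parentEdge acyclic edge
      ...   | inj₁ xy@(x≢root , refl) = trans (orient-upward up xy) (up≗ x x≢root)
      ...   | inj₂ yx@(y≢root , refl) with ρ x y in arc
      ...     | true = trans (orient-downward up yx) (cong not (trans (up≗ y y≢root) (IsOrientation.arc⇒¬arc {adj = adj} o arc)))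
      ...     | false = trans (orient-downward up yx) (cong not (trans (up≗ y y≢root) (IsOrientation.edge⇒arc {adj = adj} o edge arc)))
      orient-recover {ρ} o up up≗ x y | false with ρ x y in arc
      ... | true = case trans (sym edge) (IsOrientation.arc⇒edge {adj = adj} o arc) of λ ()
      ... | false = orient-off up (λ xy → case trans (sym edge) (parentEdge⇒edge xy) of λ ())
                                  (λ yx → case trans (sym edge) (trans (proj₁ simple x y) (parentEdge⇒edge yx)) of λ ())

      -- every edge is a parent edge, so an orientation is the choice of a direction for each of the n non-root vertices
      length-acyclicOrientations : length (acyclicOrientations adj) ≡ 2 ^ n
      length-acyclicOrientations = begin
        length (acyclicOrientations adj)                     ≡⟨ length-map (λ _ → tt) (acyclicOrientations adj) ⟨
        length (map (λ _ → tt) (acyclicOrientations adj))    ≡⟨ ↭-length (↭-sym directions↭) ⟩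
        length (map (λ _ → tt) (allFuns n bools))            ≡⟨ length-map (λ _ → tt) (allFuns n bools) ⟩
        length (allFuns n bools)                             ≡⟨ length-allFuns n bools ⟩
        2 ^ n                                                ∎
        where
        open ≡-Reasoning
        Encodes : (Fin n → Bool) → Orientation (suc n) → Set
        Encodes b ρ = orient (consF true b) ≗₂ ρ
        directions-distinct : Distinct (Pointwise _≡_) (allFuns n bools)
        directions-distinct = allFuns-distinct {R = _≡_} n bools-distinct
        directions↭ : map (λ _ → tt) (allFuns n bools) ↭ map (λ _ → tt) (acyclicOrientations adj)
        directions↭ = ↭-correspondence Encodes (λ _ → tt) (λ _ → tt)
          (distinct⇒unique (λ _ → refl) directions-distinct)
          (distinct⇒unique (λ _ _ → refl) (acyclicOrientations-distinct adj))
          (λ {b} _ → acyclicOrientations-complete adj (orient-acyclic acyclic (consF true b)))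
          (λ {ρ} ρ∈ →
            let b , b∈ , b≗ = find (allFuns-complete {R = _≡_} n (λ i → ρ (Fin.suc i) (parent (Fin.suc i))) (λ i → bools-complete _))
            in b , b∈ , orient-recover (proj₁ (∧-true⁻ (∈-acyclicOrientations⁻ {adj = adj} ρ∈))) (consF true b) λ
                 { Fin.zero 0≢root → ⊥-elim (0≢root refl) ; (Fin.suc i) _ → sym (b≗ i) })
          (λ _ ρ∈ ρ′∈ e e′ → distinct⇒≡ ≗₂-sym (acyclicOrientations-distinct adj) ρ∈ ρ′∈ λ u v → trans (sym (e u v)) (e′ u v))
          (λ {b} {b′} b∈ b′∈ _ e e′ → distinct⇒≡ (λ e i → sym (e i)) directions-distinct b∈ b′∈ λ i →
            let x = Fin.suc i
                child : IsParentEdge x (parent x)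
                child = (λ ()) , refl
            in trans (sym (orient-upward (consF true b) child)) (trans (e x (parent x)) (trans (sym (e′ x (parent x))) (orient-upward (consF true b′) child))))
          (λ _ _ _ → refl)

  length-acyclicOrientations-tree : ∀ {d} (adj : Graph d) → IsSimple adj → IsTree adj →
    length (acyclicOrientations adj) ≡ 2 ^ (d ∸ 1)
  length-acyclicOrientations-tree {zero} adj _ _ = refl
  length-acyclicOrientations-tree {suc n} adj simple (connected , acyclic) =
    RootedTree.length-acyclicOrientations adj simple connected acyclic

open import Defs
open import Data.Bool using (true)
open import Data.Fin using (Fin)
open import Data.Nat using (ℕ; suc; _∸_; _^_; _<_)
open import Data.Nat.Combinatorics using (_C_)
open import Data.Integer using (+_; _≤_)
open import Data.List using ([]; map; replicate; length)
open import Data.List.Relation.Unary.All using (All)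
open import Data.List.Relation.Binary.Permutation.Propositional using (_↭_)
open import Data.Product using (_×_; _,_)
open import Relation.Binary.PropositionalEquality using (_≡_; _≢_; subst)

corollary12 : (d : ℕ) (adj : Graph d) → IsSimple adj →
    (ξ : ℕ) → IsChromaticNumber adj ξ →
    (ω : Orientation d → Fin d → Fin d) →
    (∀ ρ → isAcyclicOrientation adj ρ ≡ true → IsNaturalLabeling ρ (ω ρ)) →
    (∀ j → All (λ e → + 0 ≤ e) (β adj ω j))
    × (β adj ω 0 ↭ replicate (length (acyclicOrientations adj)) (+ (suc d C 2)))
    × (IsTree adj → β adj ω 0 ↭ replicate (2 ^ (d ∸ 1)) (+ (suc d C 2)))
    × (β adj ω (d ∸ ξ) ≢ [] × (∀ j → d ∸ ξ < j → β adj ω j ≡ []))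
    × (β adj ω (d ∸ ξ) ↭ map (λ c → + colorSum c) (properColorings adj ξ))
corollary12 d adj simple ξ χ ω natural =
  β-nonnegative , β₀↭ ,
  (λ tree → subst (λ k → β adj ω 0 ↭ replicate k (+ (suc d C 2))) (length-acyclicOrientations-tree adj simple tree) β₀↭) ,
  (β-top≢[] , β-vanishes) , β-top↭
  where
  open Coefficients adj simple ω natural
  open LeadingCoefficient χ
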